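{- Given an ordering $\pi$ of $c$ strands with $N$ total bases, let $\mathcal{T}$ be any set of distinct rotationally symmetric (symmetry degree $\ge2$) connected unpseudoknotted secondary structures with ordering $\pi$ such that (1) any two $S_i,S_j\in\mathcal{T}$ that are both $R$-fold symmetric with $R>2$ have no admissible $R$-symmetric backbone cut in common, and (2) any two $S_i,S_j\in\mathcal{T}$ that are both $2$-fold symmetric either have no admissible $2$-symmetric backbone cut in common, or have different central internal loops. Then $|\mathcal{T}|\le\mathcal{U}$, where $\mathcal{U}=\frac{N-c}{v(\pi)}\left[\sigma(v(\pi))-v(\pi)\right]+\frac{N^2}{16}=\mathcal{O}(N^2)$ and $\sigma(m)$ is the sum of divisors of $m$.
   Context: Strands are words over $\{\mathrm{A},\mathrm{C},\mathrm{G},\mathrm{T}\}$; identical sequences have the same type; $c=\mathcal{O}(1)$. A circular ordering $\pi$ is a cyclic string over strand types; $v(\pi)$ is the largest $n$ with $\pi=y^n$ for a prefix $y$; $X^n_m$ is the $m$-th strand of type $X$ in the $n$-th copy of the shortest such prefix. Bases lie on a circle in order $\pi$. A secondary structure $S$ is a set of base pairs between complementary bases, each base in at most one pair; $\mathrm{Poly}(S,\pi)$ has covalent bonds (consecutive bases of one strand; there are $N-c$) as arcs and base pairs as chords; unpseudoknotted means no crossing chords, connected means $\mathrm{Poly}(S,\pi)$ connected. $G^\pi$ is the cyclic group generated by the rotation sending base $i$ of $X^n_m$ to base $i$ of $X^{n+1\bmod v(\pi)}_m$; $S$ is $R$-fold rotationally symmetric if the largest subgroup $H\le G^\pi$ leaving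 $S$ invariant has order $R$. For a covalent bond $b$, the $R$-symmetric backbone cut is $\mathcal{C}^b_R=\{a(b):a\in H\}$ with $|H|=R$; it is admissible for $S$ if none of its bonds lies within the shorter circular arc between the endpoints of a base pair of $S$. Removing an admissible cut leaves $R$ isomorphic connected components (symmetric slices); the central loop of $S$ is the unique loop (face of the planar polymer graph) not contained in any slice; a central internal loop is a central loop bordered by exactly two base pairs with no nick. -}

module Defs where

open import Data.Nat using (ℕ; zero; suc; _+_; _*_; _∸_; _≤_; _<_)
open import Data.Nat.DivMod using (_%_; _/_)
open import Data.Nat.Divisibility using (_∣_; _∣?_)
open import Data.Bool using (Bool; true; false; if_then_else_; _∧_)
open import Data.List using (List; []; _∷_; _++_; length; map; concat; replicate; upTo)
open import Data.Nat.ListAction using (sum)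
open import Data.Maybe using (Maybe; just; nothing)
open import Data.Product using (_×_; ∃; ∃-syntax; Σ-syntax; _,_)
open import Data.Sum using (_⊎_)
open import Data.Empty using (⊥)
open import Relation.Nullary using (¬_; does)
open import Relation.Binary.PropositionalEquality using (_≡_)

data Base : Set where
  A C G T : Base

data Compl : Base → Base → Set where
  AT : Compl A T
  TA : Compl T A
  CG : Compl C G
  GC : Compl G C

Strand : Set
Strand = List Base

-- A circular ordering, represented by a list read from a chosen start point.
Ordering : Set
Ordering = List Strand

rep : {X : Set} → ℕ → List X → List X
rep n y = concat (replicate n y)

nStrands : Ordering → ℕ
nStrands π = length π

nBases : Ordering → ℕ
nBases π = sum (map length π)

nth : {X : Set} → List X → ℕ → Maybe X
nth []       _       = nothing
nth (x ∷ xs) zero    = just x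
nth (x ∷ xs) (suc i) = nth xs i

bases : Ordering → List Base
bases π = concat π

labels : Ordering → ℕ → List ℕ
labels []       k = []
labels (s ∷ ss) k = replicate (length s) k ++ labels ss (suc k)

-- p modulo n (n > 0 in all uses)
_mod'_ : ℕ → ℕ → ℕ
p mod' zero  = p
p mod' suc n = p % suc n

-- covalent bond between base p and base p+1 (same strand)
Bond : Ordering → ℕ → Set
Bond π p = (suc p < nBases π) × (nth (labels π 0) p ≡ nth (labels π 0) (suc p))

Structure : Set
Structure = ℕ → ℕ → Bool

record IsSecStruct (π : Ordering) (S : Structure) : Set where
  field
    inRange : ∀ i j → S i j ≡ true → (i < nBases π) × (j < nBases π)
    symm    : ∀ i j → S i j ≡ true → S j i ≡ true
    compl   : ∀ i j → S i j ≡ true →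
              ∃[ b ] ∃[ b' ] (nth (bases π) i ≡ just b × nth (bases π) j ≡ just b' × Compl b b')
    atMostOne : ∀ i j k → S i j ≡ true → S i k ≡ true → j ≡ k

Unpseudoknotted : Structure → Set
Unpseudoknotted S = ∀ i j k l → S i j ≡ true → S k l ≡ true → i < k → k < j → j < l → ⊥

PolyEdge : Ordering → Structure → ℕ → ℕ → Set
PolyEdge π S p q = (Bond π p × q ≡ suc p) ⊎ ((Bond π q × p ≡ suc q) ⊎ S p q ≡ true)

data Reach (π : Ordering) (S : Structure) (p : ℕ) : ℕ → Set where
  here : Reach π S p p
  step : ∀ {q r} → Reach π S p q → PolyEdge π S q r → Reach π S p r

Connected : Ordering → Structure → Set
Connected π S = ∀ i → i < nBases π → Reach π S 0 i

-- Rotational symmetry.  π = y ^ v, with v = v(π); the generator of G^π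
-- shifts every base position by L = (number of bases of y).

shift : Ordering → Ordering → ℕ → ℕ → ℕ
shift π y k p = (p + k * nBases y) mod' nBases π

allᵇ : {X : Set} → (X → Bool) → List X → Bool
allᵇ p []       = true
allᵇ p (x ∷ xs) = p x ∧ allᵇ p xs

beq : Bool → Bool → Bool
beq true  b = b
beq false true  = false
beq false false = true

invariantᵇ : Ordering → Ordering → Structure → ℕ → Bool
invariantᵇ π y S k =
  allᵇ (λ i → allᵇ (λ j → beq (S i j) (S (shift π y k i) (shift π y k j)))
                 (upTo (nBases π)))
      (upTo (nBases π))

-- order of the largest subgroup of G^π (cyclic of order v) leaving S invariant
symDeg : Ordering → Ordering → ℕ → Structure → ℕ
symDeg π y v S = sum (map (λ k → if invariantᵇ π y S k then 1 else 0) (upTo v))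

-- p belongs to the R-symmetric backbone cut C^b_R (H = the subgroup of
-- order R of G^π ≅ ℤ/v, i.e. {k < v : v ∣ k R})
InCut : Ordering → Ordering → ℕ → ℕ → ℕ → ℕ → Set
InCut π y v R b p = ∃[ k ] (k < v × v ∣ k * R × p ≡ shift π y k b)

cdist : Ordering → ℕ → ℕ → ℕ
cdist π i j = (j + nBases π ∸ i) mod' nBases π

-- bond p lies within the clockwise arc from i to j, and that arc is a
-- shorter (i.e. not longer) arc between i and j
InShortArc : Ordering → ℕ → ℕ → ℕ → Set
InShortArc π i j p = (2 * cdist π i j ≤ nBases π) × (cdist π i p < cdist π i j)

Admissible : Ordering → Ordering → ℕ → Structure → ℕ → ℕ → Set
Admissible π y v S R b =
  Bond π b ×
  (∀ p → InCut π y v R b p → ∀ i j → S i j ≡ true → ¬ InShortArc π i j p)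

CommonCut : Ordering → Ordering → ℕ → Structure → Structure → ℕ → Set
CommonCut π y v S S' R = ∃[ b ] (Admissible π y v S R b × Admissible π y v S' R b)

-- Central internal loop of a 2-fold symmetric structure (h = N/2):
-- the face bordered by the pairs (a,b) and (a+h,b+h), with a, b, a+h, b+h
-- in clockwise order, whose two backbone arcs b→a+h and b+h→a contain only
-- unpaired interior bases and no nick.

half : Ordering → ℕ
half π = nBases π / 2

Unpaired : Structure → ℕ → Set
Unpaired S q = ∀ r → S q r ≡ false

CentralInternalLoop : Ordering → Structure → ℕ → ℕ → Set
CentralInternalLoop π S a b =
  S a b ≡ true ×
  S ((a + half π) mod' nBases π) ((b + half π) mod' nBases π) ≡ true ×
  0 < cdist π a b × cdist π a b < half π ×
  (∀ t → 0 < t → t < half π ∸ cdist π a b →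
     Unpaired S ((b + t) mod' nBases π) ×
     Unpaired S ((b + half π + t) mod' nBases π)) ×
  (∀ t → t < half π ∸ cdist π a b →
     Bond π ((b + t) mod' nBases π) ×
     Bond π ((b + half π + t) mod' nBases π))

SameLoop : Ordering → ℕ → ℕ → ℕ → ℕ → Set
SameLoop π a b a' b' =
  (a' ≡ a × b' ≡ b) ⊎
  (a' ≡ (a + half π) mod' nBases π × b' ≡ (b + half π) mod' nBases π)

DifferentCIL : Ordering → Structure → Structure → Set
DifferentCIL π S S' =
  ∃[ a ] ∃[ b ] ∃[ a' ] ∃[ b' ]
    (CentralInternalLoop π S a b × CentralInternalLoop π S' a' b' ×
     ¬ SameLoop π a b a' b')

σ : ℕ → ℕ
σ m = sum (map (λ d → if does (d ∣? m) then d else 0) (map suc (upTo m)))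

module Submission where

-- Each structure S of 𝒯 receives a code, and distinct structures receive distinct codes. Let R be the
-- symmetry degree of S and g = v / R, so that the rotation by g copies of y generates its symmetry group.
-- Symmetry rules out diameters, so the end of a longest short pair lies in no pair's short arc; if no
-- such uncovered position were a bond, an uncovered nick u and its rotation by g would disconnect
-- Poly(S, π). The orbit of an uncovered bond is an admissible R-cut, and a rotation moves the bond b
-- into the first g copies of y. Over the proper divisors g of v there are (N - c)(σ(v) - v)/v such
-- codes (g, b), and by (1) and (2) structures of equal symmetry never share one, unless they are
-- 2-fold symmetric with different central internal loops. Such a structure is coded by its central
-- internal loop instead, which is unique: its bond b and the base a + h facing its start, reduced
-- modulo the half-turn h = N / 2, are complementary positions u < w < h, and there are at most
-- (h / 2)² pairs of those.

open import Defs
open import Data.Nat using (ℕ; _+_; _*_; _∸_; _≤_; _<_)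
open import Data.List using (List; []; length; lookup)
open import Data.List.Relation.Unary.All using (All)
open import Data.List.Membership.Propositional using (_∈_)
open import Data.Fin using (Fin)
open import Data.Product using (_×_)
open import Data.Sum using (_⊎_)
open import Relation.Nullary using (¬_)
open import Relation.Binary.PropositionalEquality using (_≡_; _≢_)

open import Data.Nat hiding (Ordering)
open import Data.Nat.Properties
open import Data.Nat.DivMod
open import Data.Nat.Divisibility
  using (_∣_; _∣?_; divides; _∣0; ∣-refl; ∣⇒≤; m%n≡0⇒n∣m; ∣m+n∣m⇒∣n; ∣m∣n⇒∣m+n; *-cancelʳ-∣; n∣m*n)
open import Data.Nat.ListAction using (sum)
open import Data.Nat.ListAction.Properties using (sum-++)
open import Data.Nat.Solver using (module +-*-Solver)
open import Algebra.Properties.CommutativeSemigroup +-commutativeSemigroup using (x∙yz≈y∙xz)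
open import Data.Bool using (Bool; true; false; if_then_else_)
open import Data.Empty using (⊥; ⊥-elim)
open import Data.Fin as Fin using (Fin)
open import Data.Fin.Properties using (injective⇒≤) renaming (_≟_ to _≟ᶠ_)
open import Data.List using (_∷_; _++_; map; replicate; upTo)
open import Data.List.Properties
  using (length-++; length-replicate; map-replicate; map-++; map-∘; ++-assoc; concat-++; upTo-∷ʳ)
open import Data.List.Membership.Propositional.Properties using (∈-++⁺ˡ; ∈-++⁺ʳ; ∈-lookup; ∈-upTo⁺; ∈-upTo⁻)
open import Data.List.Relation.Unary.All using (_∷_)
import Data.List.Relation.Unary.All.Properties as All
open import Data.List.Relation.Unary.Any using (here; there; index)
open import Data.List.Relation.Unary.Any.Properties using (lookup-index)
open import Data.Maybe using (Maybe; just; nothing)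
import Data.Maybe as Maybe
open import Data.Maybe.Properties using (just-injective; map-injective) renaming (≡-dec to ≡-dec-Maybe)
open import Data.Product using (_,_; Σ-syntax; ∃-syntax; proj₁; proj₂)
open import Data.Sum using (inj₁; inj₂; [_,_]′)
open import Function using (_∘_; _$_)
open import Function.Bundles using (mk⇔)
open import Relation.Nullary using (Dec; yes; no; does; _because_; _×-dec_; contradiction)
open import Relation.Nullary.Decidable using (dec-true; dec-false; does-⇔; ¬¬-excluded-middle; decidable-stable)
open import Relation.Nullary.Negation using (¬¬-map)
open import Relation.Nullary.Reflects using (Reflects; ofʸ; ofⁿ)
open import Relation.Unary using (Decidable)
open import Relation.Binary.Definitions using (tri<; tri≈; tri>)
open import Relation.Binary.PropositionalEquality
open +-*-Solver using (solve; _:+_; _:*_; _:=_; con)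


mod'-< : ∀ p {N} → 0 < N → p mod' N < N
mod'-< p {suc m} _ = m%n<n p (suc m)

mod'-identity : ∀ {p N} → p < N → p mod' N ≡ p
mod'-identity {N = suc m} = m<n⇒m%n≡m

mod'≡% : ∀ p N .{{_ : NonZero N}} → p mod' N ≡ p % N
mod'≡% p (suc m) = refl

mod'-+N : ∀ p N → (p + N) mod' N ≡ p mod' N
mod'-+N p zero    = +-identityʳ p
mod'-+N p (suc m) = [m+n]%n≡m%n p (suc m)

mod'-absorbˡ : ∀ p q N → (p mod' N + q) mod' N ≡ (p + q) mod' N
mod'-absorbˡ p q zero    = refl
mod'-absorbˡ p q (suc m) = begin
  (p % n + q) % n           ≡⟨ %-distribˡ-+ (p % n) q n ⟩
  (p % n % n + q % n) % n   ≡⟨ cong (λ z → (z + q % n) % n) (m%n%n≡m%n p n) ⟩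
  (p % n + q % n) % n       ≡⟨ %-distribˡ-+ p q n ⟨
  (p + q) % n               ∎
  where
  n = suc m
  open ≡-Reasoning

mod'-+0 : ∀ {s N} → s < N → (s + 0) mod' N ≡ s
mod'-+0 {s} {N} sl = trans (cong (_mod' N) (+-identityʳ s)) (mod'-identity sl)

offset-rebase : ∀ N s o o' → o ≤ o' → ((s + o) mod' N + (o' ∸ o)) mod' N ≡ (s + o') mod' N
offset-rebase N s o o' le =
  trans (mod'-absorbˡ (s + o) (o' ∸ o) N) (cong (_mod' N) (trans (+-assoc s o _) (cong (s +_) (m+[n∸m]≡n le))))

data WrapView (N x o : ℕ) : Set where
  inside  : x + o < N → (x + o) mod' N ≡ x + o → WrapView N x o
  wrapped : (w : ℕ) → w + N ≡ x + o → (x + o) mod' N ≡ w → WrapView N x o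

wrapView : ∀ N x o → x < N → o < N → WrapView N x o
wrapView N x o xl ol with x + o <? N
... | yes lt = inside lt (mod'-identity lt)
... | no nlt = wrapped (x + o ∸ N) (m∸n+n≡m N≤x+o) (begin
  (x + o) mod' N          ≡⟨ cong (_mod' N) (m∸n+n≡m N≤x+o) ⟨
  (x + o ∸ N + N) mod' N  ≡⟨ mod'-+N _ N ⟩
  (x + o ∸ N) mod' N      ≡⟨ mod'-identity x+o∸N<N ⟩
  x + o ∸ N               ∎)
  where
  open ≡-Reasoning
  N≤x+o = ≮⇒≥ nlt
  x+o∸N<N : x + o ∸ N < N
  x+o∸N<N = +-cancelʳ-< N _ N (subst (_< N + N) (sym (m∸n+n≡m N≤x+o)) (+-mono-< xl ol))

twice : ∀ a → 2 * a ≡ a + a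
twice a = cong (a +_) (+-identityʳ a)

∸-+-∸ : ∀ {m n o} → m ≤ n → n ≤ o → (n ∸ m) + (o ∸ n) ≡ o ∸ m
∸-+-∸ {m} {n} {o} m≤n n≤o = begin
  (n ∸ m) + (o ∸ n)             ≡⟨ m+n∸m≡n m _ ⟨
  m + ((n ∸ m) + (o ∸ n)) ∸ m   ≡⟨ cong (_∸ m) (+-assoc m _ _) ⟨
  m + (n ∸ m) + (o ∸ n) ∸ m     ≡⟨ cong (λ z → z + (o ∸ n) ∸ m) (m+[n∸m]≡n m≤n) ⟩
  n + (o ∸ n) ∸ m               ≡⟨ cong (_∸ m) (m+[n∸m]≡n n≤o) ⟩
  o ∸ m                         ∎
  where open ≡-Reasoning

cwdist : ℕ → ℕ → ℕ → ℕ
cwdist N i j = (j + N ∸ i) mod' N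

cwdist-< : ∀ N i j → 0 < N → cwdist N i j < N
cwdist-< N i j = mod'-< _

cwdist-offset : ∀ N x o → x < N → o < N → cwdist N x ((x + o) mod' N) ≡ o
cwdist-offset N x o xl ol with wrapView N x o xl ol
... | inside _ r = begin
  ((x + o) mod' N + N ∸ x) mod' N  ≡⟨ cong (λ z → (z + N ∸ x) mod' N) r ⟩
  (x + o + N ∸ x) mod' N           ≡⟨ cong (λ z → (z ∸ x) mod' N) (+-assoc x o N) ⟩
  (x + (o + N) ∸ x) mod' N         ≡⟨ cong (_mod' N) (m+n∸m≡n x (o + N)) ⟩
  (o + N) mod' N                   ≡⟨ mod'-+N o N ⟩
  o mod' N                         ≡⟨ mod'-identity ol ⟩
  o                                ∎
  where open ≡-Reasoning
... | wrapped w q r = begin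
  ((x + o) mod' N + N ∸ x) mod' N  ≡⟨ cong (λ z → (z + N ∸ x) mod' N) r ⟩
  (w + N ∸ x) mod' N               ≡⟨ cong (λ z → (z ∸ x) mod' N) q ⟩
  (x + o ∸ x) mod' N               ≡⟨ cong (_mod' N) (m+n∸m≡n x o) ⟩
  o mod' N                         ≡⟨ mod'-identity ol ⟩
  o                                ∎
  where open ≡-Reasoning

offset-cwdist : ∀ N x y → x < N → y < N → (x + cwdist N x y) mod' N ≡ y
offset-cwdist N x y xl yl = begin
  (x + (y + N ∸ x) mod' N) mod' N  ≡⟨ cong (_mod' N) (+-comm x _) ⟩
  ((y + N ∸ x) mod' N + x) mod' N  ≡⟨ mod'-absorbˡ (y + N ∸ x) x N ⟩
  (y + N ∸ x + x) mod' N           ≡⟨ cong (_mod' N) (m∸n+n≡m (≤-trans (<⇒≤ xl) (m≤n+m N y))) ⟩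
  (y + N) mod' N                   ≡⟨ mod'-+N y N ⟩
  y mod' N                         ≡⟨ mod'-identity yl ⟩
  y                                ∎
  where open ≡-Reasoning

as-offset : ∀ N s x → s < N → x < N → x ≡ (s + cwdist N s x) mod' N
as-offset N s x sl xl = sym (offset-cwdist N s x sl xl)

offset-injective : ∀ N x o o' → x < N → o < N → o' < N → (x + o) mod' N ≡ (x + o') mod' N → o ≡ o'
offset-injective N x o o' xl ol ol' e =
  trans (sym (cwdist-offset N x o xl ol)) (trans (cong (cwdist N x) e) (cwdist-offset N x o' xl ol'))

cwdist-self : ∀ N s → s < N → cwdist N s s ≡ 0
cwdist-self N s sl = trans (cong (cwdist N s) (sym (mod'-+0 sl))) (cwdist-offset N s 0 sl (≤-<-trans z≤n sl))

cwdist≡0⇒≡ : ∀ N s x → s < N → x < N → cwdist N s x ≡ 0 → x ≡ s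
cwdist≡0⇒≡ N s x sl xl e = trans (as-offset N s x sl xl) (trans (cong (λ z → (s + z) mod' N) e) (mod'-+0 sl))

cwdist-offsets-≤ : ∀ N s o o' → s < N → o ≤ o' → o' < N →
  cwdist N ((s + o) mod' N) ((s + o') mod' N) ≡ o' ∸ o
cwdist-offsets-≤ N s o o' sl le o'l = begin
  cwdist N x ((s + o') mod' N)               ≡⟨ cong (cwdist N x) (offset-rebase N s o o' le) ⟨
  cwdist N x ((x + (o' ∸ o)) mod' N)         ≡⟨ cwdist-offset N x (o' ∸ o) (mod'-< _ (≤-<-trans z≤n sl)) (≤-<-trans (m∸n≤m o' o) o'l) ⟩
  o' ∸ o                                     ∎
  where
  open ≡-Reasoning
  x = (s + o) mod' N

cwdist-offsets-> : ∀ N s o o' → s < N → o' < o → o < N →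
  cwdist N ((s + o) mod' N) ((s + o') mod' N) ≡ N + o' ∸ o
cwdist-offsets-> N s o o' sl lt ol = begin
  cwdist N x ((s + o') mod' N)               ≡⟨ cong (cwdist N x) moved ⟨
  cwdist N x ((x + (N + o' ∸ o)) mod' N)     ≡⟨ cwdist-offset N x (N + o' ∸ o) (mod'-< _ (≤-<-trans z≤n sl)) bounded ⟩
  N + o' ∸ o                                 ∎
  where
  open ≡-Reasoning
  x = (s + o) mod' N
  o≤N+o' : o ≤ N + o'
  o≤N+o' = ≤-trans (<⇒≤ ol) (m≤m+n N o')
  bounded : N + o' ∸ o < N
  bounded = +-cancelʳ-< o _ N (subst (_< N + o) (sym (m∸n+n≡m o≤N+o')) (+-monoʳ-< N lt))
  moved : (x + (N + o' ∸ o)) mod' N ≡ (s + o') mod' N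
  moved = begin
    (x + (N + o' ∸ o)) mod' N   ≡⟨ offset-rebase N s o (N + o') o≤N+o' ⟩
    (s + (N + o')) mod' N       ≡⟨ cong (λ z → (s + z) mod' N) (+-comm N o') ⟩
    (s + (o' + N)) mod' N       ≡⟨ cong (_mod' N) (+-assoc s o' N) ⟨
    (s + o' + N) mod' N         ≡⟨ mod'-+N (s + o') N ⟩
    (s + o') mod' N             ∎

cwdist-+-cwdist : ∀ N i j → i < N → j < N → i ≢ j → cwdist N i j + cwdist N j i ≡ N
cwdist-+-cwdist N i j il jl i≢j = begin
  o + cwdist N j i                                     ≡⟨ cong₂ (λ a b → o + cwdist N a b) (as-offset N i j il jl) (sym (mod'-+0 il)) ⟩
  o + cwdist N ((i + o) mod' N) ((i + 0) mod' N)       ≡⟨ cong (o +_) (cwdist-offsets-> N i o 0 il 0<o o<N) ⟩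
  o + (N + 0 ∸ o)                                      ≡⟨ m+[n∸m]≡n (≤-trans (<⇒≤ o<N) (m≤m+n N 0)) ⟩
  N + 0                                                ≡⟨ +-identityʳ N ⟩
  N                                                    ∎
  where
  open ≡-Reasoning
  o = cwdist N i j
  o<N = cwdist-< N i j (≤-<-trans z≤n il)
  0<o : 0 < o
  0<o = n≢0⇒n>0 (λ o≡0 → i≢j (sym (cwdist≡0⇒≡ N i j il jl o≡0)))

cwdist-translate : ∀ N a b t → a < N → b < N → cwdist N ((a + t) mod' N) ((b + t) mod' N) ≡ cwdist N a b
cwdist-translate N a b t al bl =
  trans (cong (cwdist N x) b+t≡x+o) (cwdist-offset N x o (mod'-< _ (≤-<-trans z≤n al)) (cwdist-< N a b (≤-<-trans z≤n al)))
  where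
  open ≡-Reasoning
  o = cwdist N a b
  x = (a + t) mod' N
  b+t≡x+o : (b + t) mod' N ≡ (x + o) mod' N
  b+t≡x+o = begin
    (b + t) mod' N                ≡⟨ cong (λ z → (z + t) mod' N) (as-offset N a b al bl) ⟩
    ((a + o) mod' N + t) mod' N   ≡⟨ mod'-absorbˡ (a + o) t N ⟩
    (a + o + t) mod' N            ≡⟨ cong (_mod' N) (trans (+-assoc a o t) (trans (cong (a +_) (+-comm o t)) (sym (+-assoc a t o)))) ⟩
    (a + t + o) mod' N            ≡⟨ mod'-absorbˡ (a + t) o N ⟨
    (x + o) mod' N                ∎

wrapped-< : ∀ {N s o o' w w'} → w + N ≡ s + o → w' + N ≡ s + o' → o < o' → w < w'
wrapped-< {N} {s} q q' lt = +-cancelʳ-< N _ _ (subst₂ _<_ (sym q) (sym q') (+-monoʳ-< s lt))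

wrapped-<-base : ∀ {N s o w} → w + N ≡ s + o → o < N → w < s
wrapped-<-base {N} {s} q o<N = +-cancelʳ-< N _ s (subst (_< s + N) (sym q) (+-monoʳ-< s o<N))

wrapped-⊥ : ∀ {N s o o' w} → w + N ≡ s + o → o < o' → s + o' < N → ⊥
wrapped-⊥ {N} {s} {w = w} q lt l = <-irrefl refl (≤-<-trans (subst (N ≤_) q (m≤n+m N w)) (<-trans (+-monoʳ-< s lt) l))

module _ (S : Structure) (symm : ∀ i j → S i j ≡ true → S j i ≡ true) (U : Unpseudoknotted S) where

  -- Each wrap-around pattern of the offsets is a rotation of the forbidden ordering i < k < j < l.
  noCrossingFrom : ∀ N s o₁ o₂ o₃ → s < N → 0 < o₁ → o₁ < o₂ → o₂ < o₃ → o₃ < N →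
    S s ((s + o₂) mod' N) ≡ true → S ((s + o₁) mod' N) ((s + o₃) mod' N) ≡ true → ⊥
  noCrossingFrom N s o₁ o₂ o₃ sl 0<o₁ o₁<o₂ o₂<o₃ o₃<N e₁ e₂
    with wrapView N s o₁ sl (<-trans o₁<o₂ (<-trans o₂<o₃ o₃<N))
       | wrapView N s o₂ sl (<-trans o₂<o₃ o₃<N)
       | wrapView N s o₃ sl o₃<N
  ... | inside _ r₁ | inside _ r₂ | inside _ r₃ =
    U _ _ _ _ e₁ e₂ (subst (s <_) (sym r₁) (m<m+n s 0<o₁))
      (subst₂ _<_ (sym r₁) (sym r₂) (+-monoʳ-< s o₁<o₂)) (subst₂ _<_ (sym r₂) (sym r₃) (+-monoʳ-< s o₂<o₃))
  ... | inside _ r₁ | inside _ r₂ | wrapped _ q₃ r₃ =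
    U _ _ _ _ (symm _ _ e₂) e₁ (subst (_< s) (sym r₃) (wrapped-<-base q₃ o₃<N))
      (subst (s <_) (sym r₁) (m<m+n s 0<o₁)) (subst₂ _<_ (sym r₁) (sym r₂) (+-monoʳ-< s o₁<o₂))
  ... | inside _ r₁ | wrapped _ q₂ r₂ | wrapped _ q₃ r₃ =
    U _ _ _ _ (symm _ _ e₁) (symm _ _ e₂) (subst₂ _<_ (sym r₂) (sym r₃) (wrapped-< q₂ q₃ o₂<o₃))
      (subst (_< s) (sym r₃) (wrapped-<-base q₃ o₃<N)) (subst (s <_) (sym r₁) (m<m+n s 0<o₁))
  ... | wrapped _ q₁ r₁ | wrapped _ q₂ r₂ | wrapped _ q₃ r₃ =
    U _ _ _ _ e₂ (symm _ _ e₁) (subst₂ _<_ (sym r₁) (sym r₂) (wrapped-< q₁ q₂ o₁<o₂))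
      (subst₂ _<_ (sym r₂) (sym r₃) (wrapped-< q₂ q₃ o₂<o₃)) (subst (_< s) (sym r₃) (wrapped-<-base q₃ o₃<N))
  ... | _ | wrapped _ q₂ _ | inside l₃ _ = wrapped-⊥ q₂ o₂<o₃ l₃
  ... | wrapped _ q₁ _ | inside l₂ _ | _ = wrapped-⊥ q₁ o₁<o₂ l₂

  noCrossing : ∀ N s x₁ x₂ x₃ x₄ → s < N → x₁ < x₂ → x₂ < x₃ → x₃ < x₄ → x₄ < N →
    S ((s + x₁) mod' N) ((s + x₃) mod' N) ≡ true → S ((s + x₂) mod' N) ((s + x₄) mod' N) ≡ true → ⊥
  noCrossing N s x₁ x₂ x₃ x₄ sl x₁<x₂ x₂<x₃ x₃<x₄ x₄<N e₁ e₂ =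
    noCrossingFrom N ((s + x₁) mod' N) (x₂ ∸ x₁) (x₃ ∸ x₁) (x₄ ∸ x₁) (mod'-< _ (≤-<-trans z≤n sl))
      (m<n⇒0<n∸m x₁<x₂) (∸-monoˡ-< x₂<x₃ (<⇒≤ x₁<x₂)) (∸-monoˡ-< x₃<x₄ (<⇒≤ x₁<x₃)) (≤-<-trans (m∸n≤m x₄ x₁) x₄<N)
      (subst (λ b → S _ b ≡ true) (sym (rebase x₃ (<⇒≤ x₁<x₃))) e₁)
      (subst₂ (λ a b → S a b ≡ true) (sym (rebase x₂ (<⇒≤ x₁<x₂))) (sym (rebase x₄ (<⇒≤ (<-trans x₁<x₃ x₃<x₄)))) e₂)
    where
    x₁<x₃ = <-trans x₁<x₂ x₂<x₃
    rebase = offset-rebase N s x₁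

cwdist-short-either : ∀ N i j → i < N → j < N → i ≢ j → 2 * cwdist N i j ≤ N ⊎ 2 * cwdist N j i ≤ N
cwdist-short-either N i j il jl i≢j with 2 * cwdist N i j ≤? N
... | yes short = inj₁ short
... | no ¬short = inj₂ (<⇒≤ (+-cancelˡ-< N _ N (begin-strict
  N + 2 * b          <⟨ +-monoˡ-< (2 * b) (≰⇒> ¬short) ⟩
  2 * a + 2 * b      ≡⟨ *-distribˡ-+ 2 a b ⟨
  2 * (a + b)        ≡⟨ cong (2 *_) (cwdist-+-cwdist N i j il jl i≢j) ⟩
  2 * N              ≡⟨ cong (N +_) (+-identityʳ N) ⟩
  N + N              ∎)))
  where
  open ≤-Reasoning
  a = cwdist N i j
  b = cwdist N j i

mod'-half-cases : ∀ {N h b} → 0 < h → N ≡ h + h → b < N → b mod' h ≡ b ⊎ b mod' h ≡ (b + h) mod' N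
mod'-half-cases {N} {h@(suc _)} {b} _ N≡h+h b<N with b <? h
... | yes b<h = inj₁ (m<n⇒m%n≡m b<h)
... | no b≮h = inj₂ (trans (sym (m≤n⇒[n∸m]%m≡n%m h≤b)) (trans (m<n⇒m%n≡m b∸h<h) (sym wrapsOnce)))
  where
  h≤b = ≮⇒≥ b≮h
  b∸h<h : b ∸ h < h
  b∸h<h = +-cancelʳ-< h (b ∸ h) h (subst₂ _<_ (sym (m∸n+n≡m h≤b)) N≡h+h b<N)
  wrapsOnce : (b + h) mod' N ≡ b ∸ h
  wrapsOnce = begin
    (b + h) mod' N             ≡⟨ cong (λ z → (z + h) mod' N) (m∸n+n≡m h≤b) ⟨
    (b ∸ h + h + h) mod' N     ≡⟨ cong (_mod' N) (trans (+-assoc (b ∸ h) h h) (cong (b ∸ h +_) (sym N≡h+h))) ⟩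
    (b ∸ h + N) mod' N         ≡⟨ mod'-+N (b ∸ h) N ⟩
    (b ∸ h) mod' N             ≡⟨ mod'-identity (≤-<-trans (m∸n≤m b h) b<N) ⟩
    b ∸ h                      ∎
    where open ≡-Reasoning

𝟙 : Bool → ℕ
𝟙 b = if b then 1 else 0

𝟙-≤ : ∀ b → 𝟙 b ≤ 1
𝟙-≤ true  = ≤-refl
𝟙-≤ false = z≤n

Σ< : ℕ → (ℕ → ℕ) → ℕ
Σ< zero    f = 0
Σ< (suc n) f = Σ< n f + f n

Σ<-cong : ∀ n {f g} → (∀ k → k < n → f k ≡ g k) → Σ< n f ≡ Σ< n g
Σ<-cong zero    eq = refl
Σ<-cong (suc n) eq = cong₂ _+_ (Σ<-cong n (λ k k<n → eq k (m<n⇒m<1+n k<n))) (eq n ≤-refl)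

Σ<-zero : ∀ n {f} → (∀ k → k < n → f k ≡ 0) → Σ< n f ≡ 0
Σ<-zero zero    eq = refl
Σ<-zero (suc n) eq = cong₂ _+_ (Σ<-zero n (λ k k<n → eq k (m<n⇒m<1+n k<n))) (eq n ≤-refl)

Σ<-+ : ∀ m n f → Σ< (m + n) f ≡ Σ< m f + Σ< n (λ k → f (m + k))
Σ<-+ m zero    f = trans (cong (λ z → Σ< z f) (+-identityʳ m)) (sym (+-identityʳ _))
Σ<-+ m (suc n) f = begin
  Σ< (m + suc n) f                                   ≡⟨ cong (λ z → Σ< z f) (+-suc m n) ⟩
  Σ< (m + n) f + f (m + n)                           ≡⟨ cong (_+ f (m + n)) (Σ<-+ m n f) ⟩
  Σ< m f + Σ< n (λ k → f (m + k)) + f (m + n)        ≡⟨ +-assoc (Σ< m f) _ _ ⟩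
  Σ< m f + (Σ< n (λ k → f (m + k)) + f (m + n))      ∎
  where open ≡-Reasoning

Σ<-*ˡ : ∀ n c f → Σ< n (λ k → c * f k) ≡ c * Σ< n f
Σ<-*ˡ zero    c f = sym (*-zeroʳ c)
Σ<-*ˡ (suc n) c f = trans (cong (_+ c * f n) (Σ<-*ˡ n c f)) (sym (*-distribˡ-+ c (Σ< n f) (f n)))

Σ<-const-1 : ∀ n → Σ< n (λ _ → 1) ≡ n
Σ<-const-1 zero    = refl
Σ<-const-1 (suc n) = trans (cong (_+ 1) (Σ<-const-1 n)) (+-comm n 1)

Σ<-periodic : ∀ d L f → (∀ k → f (L + k) ≡ f k) → Σ< (d * L) f ≡ d * Σ< L f
Σ<-periodic zero    L f per = refl
Σ<-periodic (suc d) L f per = begin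
  Σ< (L + d * L) f                        ≡⟨ Σ<-+ L (d * L) f ⟩
  Σ< L f + Σ< (d * L) (λ k → f (L + k))   ≡⟨ cong (Σ< L f +_) (Σ<-cong (d * L) (λ k _ → per k)) ⟩
  Σ< L f + Σ< (d * L) f                   ≡⟨ cong (Σ< L f +_) (Σ<-periodic d L f per) ⟩
  Σ< L f + d * Σ< L f                     ∎
  where open ≡-Reasoning

sum-map-upTo : ∀ n f → sum (map f (upTo n)) ≡ Σ< n f
sum-map-upTo zero    f = refl
sum-map-upTo (suc n) f = begin
  sum (map f (upTo (suc n)))            ≡⟨ cong (λ z → sum (map f z)) (upTo-∷ʳ n) ⟨
  sum (map f (upTo n ++ n ∷ []))        ≡⟨ cong sum (map-++ f (upTo n) (n ∷ [])) ⟩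
  sum (map f (upTo n) ++ f n ∷ [])      ≡⟨ sum-++ (map f (upTo n)) (f n ∷ []) ⟩
  sum (map f (upTo n)) + (f n + 0)      ≡⟨ cong₂ _+_ (sum-map-upTo n f) (+-identityʳ (f n)) ⟩
  Σ< n f + f n                          ∎
  where open ≡-Reasoning

Σ<-head : ∀ n f → (∀ k → suc k < suc n → f (suc k) ≡ 0) → Σ< (suc n) f ≡ f 0
Σ<-head n f tail = begin
  Σ< (1 + n) f                       ≡⟨ Σ<-+ 1 n f ⟩
  Σ< 1 f + Σ< n (λ k → f (suc k))    ≡⟨ cong (Σ< 1 f +_) (Σ<-zero n (λ k k<n → tail k (s≤s k<n))) ⟩
  0 + f 0 + 0                        ≡⟨ +-identityʳ (f 0) ⟩
  f 0                                ∎
  where open ≡-Reasoning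

Σ<-≤-head : ∀ n f → (∀ k → suc k < n → f (suc k) ≡ 0) → Σ< n f ≤ f 0
Σ<-≤-head zero    f _    = z≤n
Σ<-≤-head (suc n) f tail = ≤-reflexive (Σ<-head n f tail)

module _ {X : Set} where

  ⋃< : ℕ → (ℕ → List X) → List X
  ⋃< zero    f = []
  ⋃< (suc n) f = ⋃< n f ++ f n

  length-⋃< : ∀ n f → length (⋃< n f) ≡ Σ< n (length ∘ f)
  length-⋃< zero    f = refl
  length-⋃< (suc n) f = trans (length-++ (⋃< n f)) (cong (_+ length (f n)) (length-⋃< n f))

  ∈-⋃< : ∀ {n f k x} → k < n → x ∈ f k → x ∈ ⋃< n f
  ∈-⋃< {suc n} {f} k<1+n x∈ with m≤n⇒m<n∨m≡n (≤-pred k<1+n)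
  ... | inj₁ k<n  = ∈-++⁺ˡ (∈-⋃< k<n x∈)
  ... | inj₂ refl = ∈-++⁺ʳ (⋃< n f) x∈

  when : Bool → List X → List X
  when true  xs = xs
  when false xs = []

  length-when : ∀ b xs → length (when b xs) ≡ 𝟙 b * length xs
  length-when true  xs = sym (+-identityʳ (length xs))
  length-when false xs = refl

  ∈-when : ∀ {b xs x} → b ≡ true → x ∈ xs → x ∈ when b xs
  ∈-when refl x∈ = x∈

NoneBelow : (ℕ → Set) → ℕ → Set
NoneBelow P n = ∀ k → k < n → ¬ P k

Least : (ℕ → Set) → ℕ → Set
Least P k = P k × NoneBelow P k

Greatest : (ℕ → Set) → ℕ → ℕ → Set
Greatest P n k = P k × (∀ j → j < n → P j → j ≤ k)

noneBelow-suc : ∀ {P n} → NoneBelow P n → ¬ P n → NoneBelow P (suc n)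
noneBelow-suc none ¬Pn k k<1+n with m≤n⇒m<n∨m≡n (≤-pred k<1+n)
... | inj₁ k<n  = none k k<n
... | inj₂ refl = ¬Pn

leastBelow : ∀ {P} → Decidable P → ∀ n → NoneBelow P n ⊎ (Σ[ k ∈ ℕ ] k < n × Least P k)
leastBelow P? zero = inj₁ (λ _ ())
leastBelow P? (suc n) with leastBelow P? n | P? n
... | inj₂ (k , k<n , least) | _      = inj₂ (k , m<n⇒m<1+n k<n , least)
... | inj₁ none              | yes Pn = inj₂ (n , ≤-refl , Pn , none)
... | inj₁ none              | no ¬Pn = inj₁ (noneBelow-suc none ¬Pn)

-- Without decidability of P, the greatest witness below n exists only up to double negation.
¬¬-greatestBelow : ∀ P n → ¬ ¬ (NoneBelow P n ⊎ (Σ[ k ∈ ℕ ] k < n × Greatest P n k))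
¬¬-greatestBelow P zero ¬result = ¬result (inj₁ (λ _ ()))
¬¬-greatestBelow P (suc n) ¬result =
  ¬¬-greatestBelow P n (λ below → ¬¬-excluded-middle (λ Pn? → ¬result (extend below Pn?)))
  where
  extend : NoneBelow P n ⊎ (Σ[ k ∈ ℕ ] k < n × Greatest P n k) → Dec (P n) →
           NoneBelow P (suc n) ⊎ (Σ[ k ∈ ℕ ] k < suc n × Greatest P (suc n) k)
  extend _ (yes Pn) = inj₂ (n , ≤-refl , Pn , λ j j<1+n _ → ≤-pred j<1+n)
  extend (inj₁ none) (no ¬Pn) = inj₁ (noneBelow-suc none ¬Pn)
  extend (inj₂ (k , k<n , Pk , max)) (no ¬Pn) = inj₂ (k , m<n⇒m<1+n k<n , Pk , max′)
    where
    max′ : ∀ j → j < suc n → P j → j ≤ k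
    max′ j j<1+n Pj with m≤n⇒m<n∨m≡n (≤-pred j<1+n)
    ... | inj₁ j<n  = max j j<n Pj
    ... | inj₂ refl = contradiction Pj ¬Pn

¬¬-Π-Fin : ∀ n {P : Fin n → Set} → (∀ i → ¬ ¬ P i) → ¬ ¬ (∀ i → P i)
¬¬-Π-Fin zero    ¬¬P ¬all = ¬all (λ ())
¬¬-Π-Fin (suc n) ¬¬P ¬all = ¬¬P Fin.zero λ P0 → ¬¬-Π-Fin n (λ i → ¬¬P (Fin.suc i)) λ Psuc → ¬all λ where
  Fin.zero    → P0
  (Fin.suc i) → Psuc i

NonEmptyStrands : Ordering → Set
NonEmptyStrands ys = All (λ s → s ≢ []) ys

module _ {X : Set} where

  nth-++ˡ : ∀ (xs ys : List X) {p} → p < length xs → nth (xs ++ ys) p ≡ nth xs p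
  nth-++ˡ (x ∷ xs) ys {zero}  _         = refl
  nth-++ˡ (x ∷ xs) ys {suc p} (s≤s lt) = nth-++ˡ xs ys lt

  nth-++ʳ : ∀ (xs ys : List X) p → nth (xs ++ ys) (length xs + p) ≡ nth ys p
  nth-++ʳ []       ys p = refl
  nth-++ʳ (x ∷ xs) ys p = nth-++ʳ xs ys p

  nth-replicate : ∀ n (x : X) {p} → p < n → nth (replicate n x) p ≡ just x
  nth-replicate (suc n) x {zero}  _        = refl
  nth-replicate (suc n) x {suc p} (s≤s lt) = nth-replicate n x lt

  nth-replicate-++ʳ : ∀ n (x : X) ys p → nth (replicate n x ++ ys) (n + p) ≡ nth ys p
  nth-replicate-++ʳ n x ys p = trans (cong (λ m → nth (replicate n x ++ ys) (m + p)) (sym (length-replicate n)))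
                                     (nth-++ʳ (replicate n x) ys p)

  nth-replicate-++ˡ : ∀ n (x : X) ys {p} → p < n → nth (replicate n x ++ ys) p ≡ just x
  nth-replicate-++ˡ n x ys lt =
    trans (nth-++ˡ (replicate n x) ys (subst (_ <_) (sym (length-replicate n)) lt)) (nth-replicate n x lt)

nth-map : ∀ {X Y : Set} (f : X → Y) xs p → nth (map f xs) p ≡ Maybe.map f (nth xs p)
nth-map f []       p       = refl
nth-map f (x ∷ xs) zero    = refl
nth-map f (x ∷ xs) (suc p) = nth-map f xs p

nBases-positive : ∀ y → NonEmptyStrands y → y ≢ [] → 0 < nBases y
nBases-positive []             _          y≢[] = contradiction refl y≢[]
nBases-positive ([] ∷ ss)      (s≢[] ∷ _) _    = contradiction refl s≢[]
nBases-positive ((b ∷ s) ∷ ss) _          _    = s≤s z≤n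

nBases-++ : ∀ xs ys → nBases (xs ++ ys) ≡ nBases xs + nBases ys
nBases-++ []       ys = refl
nBases-++ (s ∷ xs) ys = trans (cong (length s +_) (nBases-++ xs ys)) (sym (+-assoc (length s) _ _))

nBases-rep : ∀ v y → nBases (rep v y) ≡ v * nBases y
nBases-rep zero    y = refl
nBases-rep (suc v) y = trans (nBases-++ y (rep v y)) (cong (nBases y +_) (nBases-rep v y))

nStrands-rep : ∀ v y → nStrands (rep v y) ≡ v * nStrands y
nStrands-rep zero    y = refl
nStrands-rep (suc v) y = trans (length-++ y) (cong (length y +_) (nStrands-rep v y))

length-bases : ∀ ys → length (bases ys) ≡ nBases ys
length-bases []       = refl
length-bases (s ∷ ss) = trans (length-++ s) (cong (length s +_) (length-bases ss))

length-labels : ∀ ys k → length (labels ys k) ≡ nBases ys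
length-labels []       k = refl
length-labels (s ∷ ss) k =
  trans (length-++ (replicate (length s) k)) (cong₂ _+_ (length-replicate (length s)) (length-labels ss (suc k)))

labels-shift : ∀ ys m k → labels ys (m + k) ≡ map (m +_) (labels ys k)
labels-shift []       m k = refl
labels-shift (s ∷ ss) m k = begin
  replicate (length s) (m + k) ++ labels ss (suc (m + k))                   ≡⟨ cong (λ z → replicate (length s) (m + k) ++ labels ss z) (+-suc m k) ⟨
  replicate (length s) (m + k) ++ labels ss (m + suc k)                     ≡⟨ cong₂ _++_ (sym (map-replicate (m +_) (length s) k)) (labels-shift ss m (suc k)) ⟩
  map (m +_) (replicate (length s) k) ++ map (m +_) (labels ss (suc k))     ≡⟨ map-++ (m +_) (replicate (length s) k) _ ⟨
  map (m +_) (replicate (length s) k ++ labels ss (suc k))                  ∎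
  where open ≡-Reasoning

labels-++ : ∀ xs ys k → labels (xs ++ ys) k ≡ labels xs k ++ labels ys (length xs + k)
labels-++ []       ys k = refl
labels-++ (s ∷ xs) ys k = begin
  replicate (length s) k ++ labels (xs ++ ys) (suc k)                                 ≡⟨ cong (replicate (length s) k ++_) (labels-++ xs ys (suc k)) ⟩
  replicate (length s) k ++ (labels xs (suc k) ++ labels ys (length xs + suc k))     ≡⟨ cong (λ z → replicate (length s) k ++ (labels xs (suc k) ++ labels ys z)) (+-suc (length xs) k) ⟩
  replicate (length s) k ++ (labels xs (suc k) ++ labels ys (suc (length xs) + k))   ≡⟨ ++-assoc (replicate (length s) k) _ _ ⟨
  (replicate (length s) k ++ labels xs (suc k)) ++ labels ys (suc (length xs) + k)   ∎
  where open ≡-Reasoning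

nth-labels-< : ∀ ys k {r} → r < nBases ys → ∃[ l ] (nth (labels ys k) r ≡ just l × l < k + length ys)
nth-labels-< (s ∷ ss) k {r} r<n with r <? length s
... | yes r<s = k , nth-replicate-++ˡ (length s) k _ r<s , m<m+n k (s≤s z≤n)
... | no r≮s with nth-labels-< ss (suc k) {r ∸ length s} (+-cancelˡ-< (length s) _ _ (subst (_< length s + nBases ss) (sym (m+[n∸m]≡n (≮⇒≥ r≮s))) r<n))
...   | l , eq , l< = l , trans (cong (nth (labels (s ∷ ss) k)) (sym (m+[n∸m]≡n (≮⇒≥ r≮s))))
                               (trans (nth-replicate-++ʳ (length s) k _ (r ∸ length s)) eq)
                        , subst (l <_) (sym (+-suc k (length ss))) l<

nth-labels-head : ∀ ys k → NonEmptyStrands ys → ys ≢ [] → nth (labels ys k) 0 ≡ just k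
nth-labels-head []              k _          ys≢[] = contradiction refl ys≢[]
nth-labels-head ([] ∷ ss)       k (s≢[] ∷ _) _     = contradiction refl s≢[]
nth-labels-head ((b ∷ s) ∷ ss)  k _          _     = refl

nth-labels-next : ∀ ss k → NonEmptyStrands ss → nth (labels ss (suc k)) 0 ≢ just k
nth-labels-next []       k _  ()
nth-labels-next (s ∷ ss) k ne eq = 1+n≢n (just-injective (trans (sym (nth-labels-head (s ∷ ss) (suc k) ne (λ ()))) eq))

-- Bond π p, for an arbitrary label list in place of labels π 0.
Joined : List ℕ → ℕ → Set
Joined lab r = suc r < length lab × nth lab r ≡ nth lab (suc r)

joined? : ∀ lab r → Dec (Joined lab r)
joined? lab r = (suc r <? length lab) ×-dec ≡-dec-Maybe _≟_ (nth lab r) (nth lab (suc r))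

joins : List ℕ → ℕ → ℕ
joins lab n = Σ< n (𝟙 ∘ does ∘ joined? lab)

module _ (k : ℕ) (rest : List ℕ) where

  length-replicate-++ : ∀ n → length (replicate n k ++ rest) ≡ n + length rest
  length-replicate-++ n = trans (length-++ (replicate n k)) (cong (_+ length rest) (length-replicate n))

  joined-replicate : ∀ m {r} → r < m → Joined (replicate (suc m) k ++ rest) r
  joined-replicate m {r} r<m =
    subst (suc r <_) (sym (length-replicate-++ (suc m))) (≤-trans (s≤s r<m) (m≤m+n (suc m) _)) ,
    trans (nth-replicate-++ˡ (suc m) k rest (m<n⇒m<1+n r<m)) (sym (nth-replicate-++ˡ (suc m) k rest (s≤s r<m)))

  ¬joined-replicate-end : ∀ m → nth rest 0 ≢ just k → ¬ Joined (replicate (suc m) k ++ rest) m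
  ¬joined-replicate-end m next≢k (_ , eq) = next≢k (begin
    nth rest 0                                   ≡⟨ nth-replicate-++ʳ (suc m) k rest 0 ⟨
    nth (replicate (suc m) k ++ rest) (suc m + 0) ≡⟨ cong (nth (replicate (suc m) k ++ rest)) (+-identityʳ (suc m)) ⟩
    nth (replicate (suc m) k ++ rest) (suc m)     ≡⟨ eq ⟨
    nth (replicate (suc m) k ++ rest) m           ≡⟨ nth-replicate-++ˡ (suc m) k rest ≤-refl ⟩
    just k                                        ∎)
    where open ≡-Reasoning

  joined-replicate-++⇔ : ∀ n r → Joined (replicate n k ++ rest) (n + r) → Joined rest r
  joined-replicate-++⇔ n r (lt , eq) =
    +-cancelˡ-< n _ _ (subst₂ _<_ (sym (+-suc n r)) (length-replicate-++ n) lt) ,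
    trans (sym (nth-replicate-++ʳ n k rest r))
          (trans eq (trans (cong (nth (replicate n k ++ rest)) (sym (+-suc n r))) (nth-replicate-++ʳ n k rest (suc r))))

  joined-replicate-++⇐ : ∀ n r → Joined rest r → Joined (replicate n k ++ rest) (n + r)
  joined-replicate-++⇐ n r (lt , eq) =
    subst₂ _<_ (+-suc n r) (sym (length-replicate-++ n)) (+-monoʳ-< n lt) ,
    trans (nth-replicate-++ʳ n k rest r)
          (trans eq (sym (trans (cong (nth (replicate n k ++ rest)) (sym (+-suc n r))) (nth-replicate-++ʳ n k rest (suc r)))))

-- Every strand has one base without a bond to its successor: its last one.
joins-labels : ∀ ys k → NonEmptyStrands ys → joins (labels ys k) (nBases ys) + length ys ≡ nBases ys
joins-labels []               k _          = refl
joins-labels ([] ∷ ss)        k (s≢[] ∷ _) = contradiction refl s≢[]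
joins-labels ((b ∷ s) ∷ ss)   k (_ ∷ ne)   = begin
  Σ< (suc m + n) f + suc (length ss)                        ≡⟨ cong (_+ suc (length ss)) (Σ<-+ (suc m) n f) ⟩
  Σ< m f + f m + Σ< n (λ r → f (suc m + r)) + suc (length ss) ≡⟨ cong₂ (λ a b → a + f m + b + suc (length ss)) firstStrand rest ⟩
  m + f m + joins tl n + suc (length ss)                     ≡⟨ cong (λ z → m + z + joins tl n + suc (length ss)) lastBase ⟩
  m + 0 + joins tl n + suc (length ss)                       ≡⟨ arith m (joins tl n) (length ss) ⟩
  suc m + (joins tl n + length ss)                           ≡⟨ cong (suc m +_) (joins-labels ss (suc k) ne) ⟩
  suc m + n                                                  ∎
  where
  open ≡-Reasoning
  m = length s
  n = nBases ss
  tl = labels ss (suc k)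
  lab = replicate (suc m) k ++ tl
  f = 𝟙 ∘ does ∘ joined? lab
  firstStrand : Σ< m f ≡ m
  firstStrand = trans (Σ<-cong m (λ r r<m → cong 𝟙 (dec-true (joined? lab r) (joined-replicate k tl m r<m)))) (Σ<-const-1 m)
  lastBase : f m ≡ 0
  lastBase = cong 𝟙 (dec-false (joined? lab m) (¬joined-replicate-end k tl m (nth-labels-next ss k ne)))
  rest : Σ< n (λ r → f (suc m + r)) ≡ joins tl n
  rest = Σ<-cong n (λ r _ → cong 𝟙 (does-⇔ (mk⇔ (joined-replicate-++⇔ k tl (suc m) r) (joined-replicate-++⇐ k tl (suc m) r)) (joined? lab (suc m + r)) (joined? tl r)))
  arith : ∀ a b c → a + 0 + b + suc c ≡ suc a + (b + c)
  arith a b c = begin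
    a + 0 + b + suc c   ≡⟨ cong (λ z → z + b + suc c) (+-identityʳ a) ⟩
    a + b + suc c       ≡⟨ +-suc (a + b) c ⟩
    suc (a + b + c)     ≡⟨ cong suc (+-assoc a b c) ⟩
    suc a + (b + c)     ∎

pred-*-split : ∀ {m n} → 0 < m → 0 < n → (m ∸ 1) * n + (n ∸ 1) ≡ m * n ∸ 1
pred-*-split {suc m} {suc n} _ _ = +-comm (m * suc n) n

bases-++ : ∀ xs ys → bases (xs ++ ys) ≡ bases xs ++ bases ys
bases-++ xs ys = sym (concat-++ xs ys)

module Repetition (y : Ordering) where

  private
    L = nBases y
    c = nStrands y
    ly = labels y 0

  nth-bases-rep : ∀ v q r → q < v → r < L → nth (bases (rep v y)) (q * L + r) ≡ nth (bases y) r
  nth-bases-rep (suc v) zero r _ r<L = begin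
    nth (bases (y ++ rep v y)) r                 ≡⟨ cong (λ z → nth z r) (bases-++ y (rep v y)) ⟩
    nth (bases y ++ bases (rep v y)) r           ≡⟨ nth-++ˡ (bases y) _ (subst (r <_) (sym (length-bases y)) r<L) ⟩
    nth (bases y) r                              ∎
    where open ≡-Reasoning
  nth-bases-rep (suc v) (suc q) r (s≤s q<v) r<L = begin
    nth (bases (y ++ rep v y)) (L + q * L + r)                      ≡⟨ cong₂ nth (bases-++ y (rep v y)) (trans (+-assoc L (q * L) r) (cong (_+ (q * L + r)) (sym (length-bases y)))) ⟩
    nth (bases y ++ bases (rep v y)) (length (bases y) + (q * L + r)) ≡⟨ nth-++ʳ (bases y) _ _ ⟩
    nth (bases (rep v y)) (q * L + r)                               ≡⟨ nth-bases-rep v q r q<v r<L ⟩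
    nth (bases y) r                                                 ∎
    where open ≡-Reasoning

  nth-labels-rep : ∀ v q r → q < v → r < L → nth (labels (rep v y) 0) (q * L + r) ≡ Maybe.map (q * c +_) (nth ly r)
  nth-labels-rep (suc v) zero r _ r<L = begin
    nth (labels (y ++ rep v y) 0) r              ≡⟨ cong (λ z → nth z r) (labels-++ y (rep v y) 0) ⟩
    nth (ly ++ labels (rep v y) (c + 0)) r       ≡⟨ nth-++ˡ ly _ (subst (r <_) (sym (length-labels y 0)) r<L) ⟩
    nth ly r                                     ≡⟨ Maybe-map-0+ (nth ly r) ⟩
    Maybe.map (0 +_) (nth ly r)                  ∎
    where
    open ≡-Reasoning
    Maybe-map-0+ : ∀ m → m ≡ Maybe.map (0 +_) m
    Maybe-map-0+ (just x) = refl
    Maybe-map-0+ nothing  = refl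
  nth-labels-rep (suc v) (suc q) r (s≤s q<v) r<L = begin
    nth (labels (y ++ rep v y) 0) (L + q * L + r)                        ≡⟨ cong₂ nth (labels-++ y (rep v y) 0) (trans (+-assoc L (q * L) r) (cong (_+ (q * L + r)) (sym (length-labels y 0)))) ⟩
    nth (ly ++ labels (rep v y) (c + 0)) (length ly + (q * L + r))       ≡⟨ nth-++ʳ ly _ _ ⟩
    nth (labels (rep v y) (c + 0)) (q * L + r)                           ≡⟨ cong (λ z → nth z (q * L + r)) (labels-shift (rep v y) c 0) ⟩
    nth (map (c +_) (labels (rep v y) 0)) (q * L + r)                    ≡⟨ nth-map (c +_) (labels (rep v y) 0) (q * L + r) ⟩
    Maybe.map (c +_) (nth (labels (rep v y) 0) (q * L + r))              ≡⟨ cong (Maybe.map (c +_)) (nth-labels-rep v q r q<v r<L) ⟩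
    Maybe.map (c +_) (Maybe.map (q * c +_) (nth ly r))                   ≡⟨ Maybe-map-+-+ (nth ly r) ⟩
    Maybe.map (suc q * c +_) (nth ly r)                                  ∎
    where
    open ≡-Reasoning
    Maybe-map-+-+ : ∀ m → Maybe.map (c +_) (Maybe.map (q * c +_) m) ≡ Maybe.map (suc q * c +_) m
    Maybe-map-+-+ (just x) = cong just (sym (+-assoc c (q * c) x))
    Maybe-map-+-+ nothing  = refl

  next-copy : ∀ q r → suc r ≡ L → suc (q * L + r) ≡ suc q * L + 0
  next-copy q r r+1≡L = trans (sym (+-suc (q * L) r)) (trans (cong (q * L +_) r+1≡L) (trans (+-comm (q * L) L) (sym (+-identityʳ _))))

  module _ (v : ℕ) where

    private
      π = rep v y

    ¬bond-copy-end : NonEmptyStrands y → y ≢ [] → ∀ q r → q < v → suc r ≡ L → ¬ Bond π (q * L + r)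
    ¬bond-copy-end ne y≢[] q r q<v r+1≡L (lt , eq) with suc q <? v
    ... | no q+1≮v = <-irrefl endOfπ (subst (_< nBases π) (next-copy q r r+1≡L) lt)
      where
      endOfπ : suc q * L + 0 ≡ nBases π
      endOfπ = trans (+-identityʳ _) (trans (cong (_* L) (≤-antisym q<v (≮⇒≥ q+1≮v))) (sym (nBases-rep v y)))
    ... | yes q+1<v with nth-labels-< y 0 (subst (r <_) r+1≡L ≤-refl)
    ...   | l , nth≡ , l<c = <-irrefl (+-cancelˡ-≡ (q * c) l c (just-injective labels≡)) l<c
      where
      labels≡ : just (q * c + l) ≡ just (q * c + c)
      labels≡ = begin
        just (q * c + l)                              ≡⟨ cong (Maybe.map (q * c +_)) nth≡ ⟨
        Maybe.map (q * c +_) (nth ly r)               ≡⟨ nth-labels-rep v q r q<v (subst (r <_) r+1≡L ≤-refl) ⟨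
        nth (labels π 0) (q * L + r)                  ≡⟨ eq ⟩
        nth (labels π 0) (suc (q * L + r))            ≡⟨ cong (nth (labels π 0)) (next-copy q r r+1≡L) ⟩
        nth (labels π 0) (suc q * L + 0)              ≡⟨ nth-labels-rep v (suc q) 0 q+1<v (subst (0 <_) r+1≡L (s≤s z≤n)) ⟩
        Maybe.map (suc q * c +_) (nth ly 0)           ≡⟨ cong (Maybe.map (suc q * c +_)) (nth-labels-head y 0 ne y≢[]) ⟩
        just (c + q * c + 0)                          ≡⟨ cong just (trans (+-identityʳ _) (+-comm c (q * c))) ⟩
        just (q * c + c)                              ∎
        where open ≡-Reasoning

    bond-rep⇒joined : NonEmptyStrands y → y ≢ [] → ∀ q r → q < v → r < L → Bond π (q * L + r) → Joined ly r
    bond-rep⇒joined ne y≢[] q r q<v r<L bond@(_ , eq) with suc r <? L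
    ... | no r+1≮L = contradiction bond (¬bond-copy-end ne y≢[] q r q<v (≤-antisym r<L (≮⇒≥ r+1≮L)))
    ... | yes r+1<L = subst (suc r <_) (sym (length-labels y 0)) r+1<L , map-injective (+-cancelˡ-≡ (q * c) _ _) (begin
      Maybe.map (q * c +_) (nth ly r)          ≡⟨ nth-labels-rep v q r q<v r<L ⟨
      nth (labels π 0) (q * L + r)             ≡⟨ eq ⟩
      nth (labels π 0) (suc (q * L + r))       ≡⟨ cong (nth (labels π 0)) (+-suc (q * L) r) ⟨
      nth (labels π 0) (q * L + suc r)         ≡⟨ nth-labels-rep v q (suc r) q<v r+1<L ⟩
      Maybe.map (q * c +_) (nth ly (suc r))    ∎)
      where open ≡-Reasoning

    joined⇒bond-rep : ∀ q r → q < v → Joined ly r → Bond π (q * L + r)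
    joined⇒bond-rep q r q<v (lt , eq) = inRange , sameLabel
      where
      r+1<L : suc r < L
      r+1<L = subst (suc r <_) (length-labels y 0) lt
      inRange : suc (q * L + r) < nBases π
      inRange = begin-strict
        suc (q * L + r)    ≡⟨ +-suc (q * L) r ⟨
        q * L + suc r      <⟨ +-monoʳ-< (q * L) r+1<L ⟩
        q * L + L          ≡⟨ +-comm (q * L) L ⟩
        suc q * L          ≤⟨ *-monoˡ-≤ L q<v ⟩
        v * L              ≡⟨ nBases-rep v y ⟨
        nBases π           ∎
        where open ≤-Reasoning
      sameLabel : nth (labels π 0) (q * L + r) ≡ nth (labels π 0) (suc (q * L + r))
      sameLabel = begin
        nth (labels π 0) (q * L + r)             ≡⟨ nth-labels-rep v q r q<v (<-trans (n<1+n r) r+1<L) ⟩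
        Maybe.map (q * c +_) (nth ly r)          ≡⟨ cong (Maybe.map (q * c +_)) eq ⟩
        Maybe.map (q * c +_) (nth ly (suc r))    ≡⟨ nth-labels-rep v q (suc r) q<v r+1<L ⟨
        nth (labels π 0) (q * L + suc r)         ≡⟨ cong (nth (labels π 0)) (+-suc (q * L) r) ⟩
        nth (labels π 0) (suc (q * L + r))       ∎
        where open ≡-Reasoning

    module _ .{{_ : NonZero L}} where

      private
        quotient< : ∀ p → p < nBases π → p / L < v
        quotient< p p<N = m<n*o⇒m/o<n (subst (p <_) (nBases-rep v y) p<N)

        split : ∀ p → p ≡ p / L * L + p % L
        split p = trans (m≡m%n+[m/n]*n p L) (+-comm (p % L) _)

      bond⇒joined-% : NonEmptyStrands y → y ≢ [] → ∀ p → Bond π p → Joined ly (p % L)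
      bond⇒joined-% ne y≢[] p bond = bond-rep⇒joined ne y≢[] (p / L) (p % L) (quotient< p (<-trans (n<1+n p) (proj₁ bond))) (m%n<n p L)
                                              (subst (Bond π) (split p) bond)

      joined-%⇒bond : ∀ p → p < nBases π → Joined ly (p % L) → Bond π p
      joined-%⇒bond p p<N j = subst (Bond π) (sym (split p)) (joined⇒bond-rep (p / L) (p % L) (quotient< p p<N) j)

      nth-bases-rep-% : ∀ p → p < nBases π → nth (bases π) p ≡ nth (bases y) (p % L)
      nth-bases-rep-% p p<N = trans (cong (nth (bases π)) (split p)) (nth-bases-rep v (p / L) (p % L) (quotient< p p<N) (m%n<n p L))

-- Rotational symmetry

allᵇ-sound : ∀ {X : Set} (f : X → Bool) xs {x} → allᵇ f xs ≡ true → x ∈ xs → f x ≡ true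
allᵇ-sound f (x ∷ xs) eq (here refl) with f x | eq
... | true | _ = refl
allᵇ-sound f (x ∷ xs) eq (there x∈xs) with f x | eq
... | true | eq′ = allᵇ-sound f xs eq′ x∈xs

allᵇ-complete : ∀ {X : Set} (f : X → Bool) xs → (∀ x → x ∈ xs → f x ≡ true) → allᵇ f xs ≡ true
allᵇ-complete f []       all = refl
allᵇ-complete f (x ∷ xs) all with f x | all x (here refl)
... | true | _ = allᵇ-complete f xs (λ z z∈xs → all z (there z∈xs))

beq-sound : ∀ a b → beq a b ≡ true → a ≡ b
beq-sound true  true  _ = refl
beq-sound false false _ = refl

beq-refl : ∀ a → beq a a ≡ true
beq-refl true  = refl
beq-refl false = refl

multiples-below : ∀ g .{{_ : NonZero g}} → Σ< g (𝟙 ∘ does ∘ (g ∣?_)) ≡ 1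
multiples-below g@(suc g′) = trans (Σ<-head g′ _ (λ k k+1<g → cong 𝟙 (dec-false (g ∣? suc k) (λ g∣ → <⇒≱ k+1<g (∣⇒≤ g∣)))))
                                    (cong 𝟙 (dec-true (g ∣? 0) (g ∣0)))

module Rotations (y : Ordering) (v : ℕ) {{_ : NonZero v}} (0<L : 0 < nBases y) where

  π = rep v y
  N = nBases π
  L = nBases y

  N≡v*L : N ≡ v * L
  N≡v*L = nBases-rep v y

  0<N : 0 < N
  0<N = subst (0 <_) (sym N≡v*L) (*-mono-< {0} {v} {0} {L} (>-nonZero⁻¹ v) 0<L)

  instance
    N≢0 : NonZero N
    N≢0 = >-nonZero 0<N

  rotate : ℕ → ℕ → ℕ
  rotate = shift π y

  rotate-< : ∀ k p → rotate k p < N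
  rotate-< k p = mod'-< _ 0<N

  rotate-0 : ∀ {p} → p < N → rotate 0 p ≡ p
  rotate-0 = mod'-+0

  rotate-v : ∀ {p} → p < N → rotate v p ≡ p
  rotate-v {p} p<N = trans (cong (λ z → (p + z) mod' N) (sym N≡v*L)) (trans (mod'-+N p N) (mod'-identity p<N))

  rotate-+ : ∀ k k' p → rotate k' (rotate k p) ≡ rotate (k + k') p
  rotate-+ k k' p = trans (mod'-absorbˡ (p + k * L) (k' * L) N)
                          (cong (_mod' N) (trans (+-assoc p _ _) (cong (p +_) (sym (*-distribʳ-+ L k k')))))

  rotate-inverse : ∀ k {p} → k ≤ v → p < N → rotate k (rotate (v ∸ k) p) ≡ p
  rotate-inverse k {p} k≤v p<N = trans (rotate-+ (v ∸ k) k p) (trans (cong (λ z → rotate z p) (m∸n+n≡m k≤v)) (rotate-v p<N))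

  cwdist-rotate : ∀ k {a b} → a < N → b < N → cwdist N (rotate k a) (rotate k b) ≡ cwdist N a b
  cwdist-rotate k = cwdist-translate N _ _ (k * L)

  module _ {{_ : NonZero L}} where

    nth-bases-rotate : ∀ k {i} → i < N → nth (bases π) (rotate k i) ≡ nth (bases π) i
    nth-bases-rotate k {i} i<N = begin
      nth (bases π) (rotate k i)                 ≡⟨ nth-bases-rep-% v (rotate k i) (rotate-< k i) ⟩
      nth (bases y) (rotate k i % L)             ≡⟨ cong (λ z → nth (bases y) (z % L)) (mod'≡% (i + k * L) N) ⟩
      nth (bases y) ((i + k * L) % N % L)        ≡⟨ cong (nth (bases y)) (m∣n⇒o%n%m≡o%m L N (i + k * L) L∣N) ⟩
      nth (bases y) ((i + k * L) % L)            ≡⟨ cong (nth (bases y)) ([m+kn]%n≡m%n i k L) ⟩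
      nth (bases y) (i % L)                      ≡⟨ nth-bases-rep-% v i i<N ⟨
      nth (bases π) i                            ∎
      where
      open ≡-Reasoning
      open Repetition y using (nth-bases-rep-%)
      L∣N : L ∣ N
      L∣N = divides v N≡v*L

  module _ (S : Structure) where

    Invariant : ℕ → Set
    Invariant k = ∀ i j → i < N → j < N → S i j ≡ S (rotate k i) (rotate k j)

    invariantᵇ⇒ : ∀ k → invariantᵇ π y S k ≡ true → Invariant k
    invariantᵇ⇒ k eq i j i<N j<N =
      beq-sound _ _ (allᵇ-sound _ (upTo N) (allᵇ-sound _ (upTo N) eq (∈-upTo⁺ i<N)) (∈-upTo⁺ j<N))

    ⇒invariantᵇ : ∀ k → Invariant k → invariantᵇ π y S k ≡ true
    ⇒invariantᵇ k inv = allᵇ-complete _ (upTo N) λ i i∈ → allᵇ-complete _ (upTo N) λ j j∈ →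
      subst (λ b → beq (S i j) b ≡ true) (inv i j (∈-upTo⁻ i∈) (∈-upTo⁻ j∈)) (beq-refl (S i j))

    invariant? : ∀ k → Dec (Invariant k)
    invariant? k = invariantᵇ π y S k because reflects
      where
      reflects : Reflects (Invariant k) (invariantᵇ π y S k)
      reflects with invariantᵇ π y S k in eq
      ... | true  = ofʸ (invariantᵇ⇒ k eq)
      ... | false = ofⁿ (λ inv → contradiction (trans (sym (⇒invariantᵇ k inv)) eq) (λ ()))

    symDeg≡ : symDeg π y v S ≡ Σ< v (𝟙 ∘ does ∘ invariant?)
    symDeg≡ = sum-map-upTo v _

    invariant-0 : Invariant 0
    invariant-0 i j i<N j<N = sym (cong₂ S (rotate-0 i<N) (rotate-0 j<N))

    invariant-v : Invariant v
    invariant-v i j i<N j<N = sym (cong₂ S (rotate-v i<N) (rotate-v j<N))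

    invariant-+ : ∀ k k' → Invariant k → Invariant k' → Invariant (k + k')
    invariant-+ k k' inv inv' i j i<N j<N =
      trans (inv i j i<N j<N) (trans (inv' _ _ (rotate-< k i) (rotate-< k j)) (cong₂ S (rotate-+ k k' i) (rotate-+ k k' j)))

    invariant-∸ : ∀ k k' → Invariant k → Invariant (k + k') → Invariant k'
    invariant-∸ k k' inv inv+ i j i<N j<N = begin
      S i j                                               ≡⟨ inv+ i j i<N j<N ⟩
      S (rotate (k + k') i) (rotate (k + k') j)           ≡⟨ cong₂ (λ a b → S (rotate a i) (rotate b j)) (+-comm k k') (+-comm k k') ⟩
      S (rotate (k' + k) i) (rotate (k' + k) j)           ≡⟨ cong₂ S (rotate-+ k' k i) (rotate-+ k' k j) ⟨
      S (rotate k (rotate k' i)) (rotate k (rotate k' j)) ≡⟨ inv _ _ (rotate-< k' i) (rotate-< k' j) ⟨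
      S (rotate k' i) (rotate k' j)                       ∎
      where open ≡-Reasoning

    invariant-* : ∀ q {g} → Invariant g → Invariant (q * g)
    invariant-* zero    inv = invariant-0
    invariant-* (suc q) {g} inv = invariant-+ g (q * g) inv (invariant-* q inv)

    record Generator : Set where
      field
        g : ℕ
        0<g : 0 < g
        g*R≡v : g * symDeg π y v S ≡ v
        invariant-∣ : ∀ k → g ∣ k → Invariant k

    PositiveInvariant : ℕ → Set
    PositiveInvariant k = 0 < k × Invariant k

    -- The invariant rotations form a subgroup of the cyclic group of order v, hence they are
    -- exactly the multiples of the least positive one.
    module LeastInvariant {g : ℕ} (least : Least PositiveInvariant g) where

      0<g : 0 < g
      0<g = proj₁ (proj₁ least)

      instance
        g≢0 : NonZero g
        g≢0 = >-nonZero 0<g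

      invariant-∣ : ∀ k → g ∣ k → Invariant k
      invariant-∣ _ (divides q refl) = invariant-* q (proj₂ (proj₁ least))

      ∣-invariant : ∀ k → Invariant k → g ∣ k
      ∣-invariant k inv = m%n≡0⇒n∣m k g (n≤0⇒n≡0 (≮⇒≥ λ 0<r → proj₂ least (k % g) (m%n<n k g) (0<r , inv-r)))
        where
        inv-r : Invariant (k % g)
        inv-r = invariant-∸ (k / g * g) (k % g) (invariant-* (k / g) (proj₂ (proj₁ least)))
                            (subst Invariant (trans (m≡m%n+[m/n]*n k g) (+-comm (k % g) _)) inv)

      g∣v : g ∣ v
      g∣v = ∣-invariant v invariant-v

      count : Σ< v (𝟙 ∘ does ∘ invariant?) ≡ v / g
      count = begin
        Σ< v (𝟙 ∘ does ∘ invariant?)               ≡⟨ Σ<-cong v (λ k _ → cong 𝟙 (does-⇔ (mk⇔ (∣-invariant k) (invariant-∣ k)) (invariant? k) (g ∣? k))) ⟩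
        Σ< v (𝟙 ∘ does ∘ (g ∣?_))                  ≡⟨ cong (λ z → Σ< z (𝟙 ∘ does ∘ (g ∣?_))) (m/n*n≡m g∣v) ⟨
        Σ< (v / g * g) (𝟙 ∘ does ∘ (g ∣?_))        ≡⟨ Σ<-periodic (v / g) g _ (λ k → cong 𝟙 (does-⇔ (mk⇔ (∣m+n∣m⇒∣n′ k) (∣m∣n⇒∣m+n ∣-refl)) (g ∣? (g + k)) (g ∣? k))) ⟩
        v / g * Σ< g (𝟙 ∘ does ∘ (g ∣?_))          ≡⟨ cong (v / g *_) (multiples-below g) ⟩
        v / g * 1                                  ≡⟨ *-identityʳ (v / g) ⟩
        v / g                                      ∎
        where
        open ≡-Reasoning
        ∣m+n∣m⇒∣n′ : ∀ k → g ∣ g + k → g ∣ k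
        ∣m+n∣m⇒∣n′ k g∣g+k = ∣m+n∣m⇒∣n g∣g+k ∣-refl

      generator : Generator
      generator = record
        { g = g
        ; 0<g = 0<g
        ; g*R≡v = trans (cong (g *_) (trans symDeg≡ count)) (m*[n/m]≡n g∣v)
        ; invariant-∣ = invariant-∣
        }

    generator : 2 ≤ symDeg π y v S → Generator
    generator 2≤R with leastBelow (λ k → (0 <? k) ×-dec invariant? k) v
    ... | inj₂ (g , _ , least) = LeastInvariant.generator least
    ... | inj₁ none = contradiction (≤-trans (≤-trans 2≤R (≤-reflexive symDeg≡)) R≤1) (λ { (s≤s ()) })
      where
      f = 𝟙 ∘ does ∘ invariant?
      R≤1 : Σ< v f ≤ 1
      R≤1 = ≤-trans (Σ<-≤-head v f (λ k k+1<v → cong 𝟙 (dec-false (invariant? (suc k)) (λ inv → none (suc k) k+1<v (s≤s z≤n , inv)))))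
                    (𝟙-≤ (does (invariant? 0)))

-- Uncovered positions

module Planar (π : Ordering) (S : Structure) (ss : IsSecStruct π S) (U : Unpseudoknotted S) where

  open IsSecStruct ss

  N = nBases π

  Uncovered : ℕ → Set
  Uncovered p = ∀ i j → S i j ≡ true → ¬ InShortArc π i j p

  NoDiameter : Set
  NoDiameter = ∀ i j → S i j ≡ true → 2 * cwdist N i j ≢ N

  pair-<₁ : ∀ {i j} → S i j ≡ true → i < N
  pair-<₁ e = proj₁ (inRange _ _ e)

  pair-<₂ : ∀ {i j} → S i j ≡ true → j < N
  pair-<₂ e = proj₂ (inRange _ _ e)

  pair-≢ : ∀ {i j} → S i j ≡ true → i ≢ j
  pair-≢ {i} e refl with compl i i e
  ... | b , b' , eb , eb' , c with trans (sym eb) eb'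
  ...   | refl with c
  ...     | ()

  pair-unique : ∀ {i j k} → S i j ≡ true → S k i ≡ true → k ≡ j
  pair-unique e e' = atMostOne _ _ _ (symm _ _ e') e

  at : ℕ → ℕ → ℕ
  at s o = (s + o) mod' N

  -- Positions are measured clockwise from i'.
  module LongestShortPair (noDiam : NoDiameter) {i j : ℕ} (e : S i j ≡ true) (short : 2 * cwdist N i j ≤ N)
    (longest : ∀ i' j' → S i' j' ≡ true → 2 * cwdist N i' j' ≤ N → cwdist N i' j' ≤ cwdist N i j)
    {i' j' : ℕ} (e' : S i' j' ≡ true) (short' : 2 * cwdist N i' j' ≤ N) (cov : cwdist N i' j < cwdist N i' j') where

    D = cwdist N i j
    o = cwdist N i' j
    oi = cwdist N i' i
    D' = cwdist N i' j'
    i<N = pair-<₁ e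
    j<N = pair-<₂ e
    i'<N = pair-<₁ e'
    0<N = ≤-<-trans z≤n i'<N
    oi<N = cwdist-< N i' i 0<N
    D'≤D = longest i' j' e' short'
    i≡ = as-offset N i' i i'<N i<N
    j≡ = as-offset N i' j i'<N j<N
    j'≡ = as-offset N i' j' i'<N (pair-<₂ e')

    -- j = i' forces j' = i, and then (i, j) would be a diameter.
    j-not-start : o ≢ 0
    j-not-start o≡0 = noDiam i j e (trans (twice D) (trans (cong (D +_) D≡D*) (cwdist-+-cwdist N i j i<N j<N (pair-≢ e))))
      where
      j≡i' : j ≡ i'
      j≡i' = cwdist≡0⇒≡ N i' j i'<N j<N o≡0
      D*≡D' : cwdist N j i ≡ D'
      D*≡D' = cong₂ (cwdist N) j≡i' (pair-unique e' (subst (λ z → S i z ≡ true) j≡i' e))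
      D≡D* : D ≡ cwdist N j i
      D≡D* = ≤-antisym (+-cancelˡ-≤ D D _ (subst₂ _≤_ (twice D) (sym (cwdist-+-cwdist N i j i<N j<N (pair-≢ e))) short))
                       (subst (_≤ D) (sym D*≡D') D'≤D)

    i-not-j : oi ≢ o
    i-not-j oi≡o = pair-≢ e (trans i≡ (trans (cong (at i') oi≡o) (sym j≡)))

    i-not-before-j : ¬ oi < o
    i-not-before-j oi<o = <-irrefl refl (begin-strict
      D                             ≡⟨ cong₂ (cwdist N) i≡ j≡ ⟩
      cwdist N (at i' oi) (at i' o) ≡⟨ cwdist-offsets-≤ N i' oi o i'<N (<⇒≤ oi<o) (cwdist-< N i' j 0<N) ⟩
      o ∸ oi                        ≤⟨ m∸n≤m o oi ⟩
      o                             <⟨ cov ⟩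
      D'                            ≤⟨ D'≤D ⟩
      D                             ∎)
      where open ≤-Reasoning

    i-not-within : o < oi → ¬ oi < D'
    i-not-within o<oi oi<D' = <-irrefl refl (<-≤-trans longer short)
      where
      open ≤-Reasoning
      D≡ : D ≡ N + o ∸ oi
      D≡ = trans (cong₂ (cwdist N) i≡ j≡) (cwdist-offsets-> N i' oi o i'<N o<oi oi<N)
      longer : N < 2 * D
      longer = begin-strict
        N               ≤⟨ m≤m+n N o ⟩
        N + o           ≡⟨ m∸n+n≡m (≤-trans (<⇒≤ oi<N) (m≤m+n N o)) ⟨
        N + o ∸ oi + oi ≡⟨ cong (_+ oi) D≡ ⟨
        D + oi          <⟨ +-monoʳ-< D (<-≤-trans oi<D' D'≤D) ⟩
        D + D           ≡⟨ twice D ⟨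
        2 * D           ∎

    i-not-j' : oi ≢ D'
    i-not-j' oi≡D' = j-not-start (trans (cong (cwdist N i') j≡i') (cwdist-self N i' i'<N))
      where
      j≡i' : j ≡ i'
      j≡i' = sym (pair-unique e (subst (λ z → S i' z ≡ true) (trans j'≡ (trans (cong (at i') (sym oi≡D')) (sym i≡))) e'))

    i-not-beyond : ¬ D' < oi
    i-not-beyond D'<oi = noCrossingFrom S symm U N i' o D' oi i'<N (n≢0⇒n>0 j-not-start) cov D'<oi oi<N
                           (subst (λ z → S i' z ≡ true) j'≡ e') (subst₂ (λ a b → S a b ≡ true) j≡ i≡ (symm i j e))

  longest-end-uncovered : NoDiameter → ∀ {i j} → S i j ≡ true → 2 * cwdist N i j ≤ N →
    (∀ i' j' → S i' j' ≡ true → 2 * cwdist N i' j' ≤ N → cwdist N i' j' ≤ cwdist N i j) → Uncovered j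
  longest-end-uncovered noDiam e short longest i' j' e' (short' , cov) = wherever-i-lies
    where
    open LongestShortPair noDiam e short longest e' short' cov
    wherever-i-lies : ⊥
    wherever-i-lies with <-cmp oi o | <-cmp oi D'
    ... | tri< oi<o _ _ | _             = i-not-before-j oi<o
    ... | tri≈ _ oi≡o _ | _             = i-not-j oi≡o
    ... | tri> _ _ o<oi | tri< oi<D' _ _ = i-not-within o<oi oi<D'
    ... | tri> _ _ _    | tri≈ _ oi≡D' _ = i-not-j' oi≡D'
    ... | tri> _ _ _    | tri> _ _ D'<oi = i-not-beyond D'<oi

  ShortPairOfLength : ℕ → Set
  ShortPairOfLength D = Σ[ i ∈ ℕ ] Σ[ j ∈ ℕ ] S i j ≡ true × 2 * cwdist N i j ≤ N × cwdist N i j ≡ D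

  ¬¬-uncovered : 0 < N → NoDiameter → ¬ ¬ (Σ[ u ∈ ℕ ] u < N × Uncovered u)
  ¬¬-uncovered 0<N noDiam ¬uncovered = ¬¬-greatestBelow ShortPairOfLength N λ where
    (inj₁ none) → ¬uncovered (0 , 0<N , λ i j e (short , _) → none (cwdist N i j) (cwdist-< N i j 0<N) (i , j , e , short , refl))
    (inj₂ (_ , _ , (i , j , e , short , refl) , longest)) →
      ¬uncovered (j , pair-<₂ e , longest-end-uncovered noDiam e short
        (λ i' j' e' short' → longest (cwdist N i' j') (cwdist-< N i' j' 0<N) (i' , j' , e' , short' , refl)))

  -- Two uncovered positions that are not bonds cut Poly(S, π) into the two arcs between them:
  -- "lies on the arc from u₀ + 1 to u₁" is preserved along bonds and pairs.
  module Separation (nicks : ∀ p → p < N → Uncovered p → ¬ Bond π p)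
                    {u₀ u₁ : ℕ} (u₀<N : u₀ < N) (u₁<N : u₁ < N) (u₀≢u₁ : u₀ ≢ u₁)
                    (unc₀ : Uncovered u₀) (unc₁ : Uncovered u₁) where

    private
      0<N = ≤-<-trans z≤n u₀<N
      s = at u₀ 1
      s<N = mod'-< (u₀ + 1) 0<N
      n = N ∸ 1
      n+1≡N : suc n ≡ N
      n+1≡N = m+[n∸m]≡n 0<N
      n<N = subst (n <_) n+1≡N ≤-refl

    offset : ℕ → ℕ
    offset = cwdist N s

    offset-< : ∀ x → offset x < N
    offset-< x = cwdist-< N s x 0<N

    offset-u₀ : offset u₀ ≡ n
    offset-u₀ = trans (cong offset (sym u₀≡)) (cwdist-offset N s n s<N n<N)
      where
      u₀≡ : at s n ≡ u₀
      u₀≡ = begin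
        at (at u₀ 1) n        ≡⟨ mod'-absorbˡ (u₀ + 1) n N ⟩
        (u₀ + 1 + n) mod' N   ≡⟨ cong (_mod' N) (trans (+-assoc u₀ 1 n) (cong (u₀ +_) n+1≡N)) ⟩
        (u₀ + N) mod' N       ≡⟨ mod'-+N u₀ N ⟩
        u₀ mod' N             ≡⟨ mod'-identity u₀<N ⟩
        u₀                    ∎
        where open ≡-Reasoning

    at-offset : ∀ {x} → x < N → at s (offset x) ≡ x
    at-offset {x} x<N = offset-cwdist N s x s<N x<N

    offset-cancel : ∀ {x x'} → x < N → x' < N → offset x ≡ offset x' → x ≡ x'
    offset-cancel {x} {x'} x<N x'<N eq = trans (sym (at-offset x<N)) (trans (cong (at s) eq) (at-offset x'<N))

    cwdist-offsets-≤′ : ∀ {x x'} → x < N → x' < N → offset x ≤ offset x' → cwdist N x x' ≡ offset x' ∸ offset x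
    cwdist-offsets-≤′ x<N x'<N le =
      trans (sym (cong₂ (cwdist N) (at-offset x<N) (at-offset x'<N))) (cwdist-offsets-≤ N s _ _ s<N le (offset-< _))

    cwdist-offsets->′ : ∀ {x x'} → x < N → x' < N → offset x' < offset x → cwdist N x x' ≡ N + offset x' ∸ offset x
    cwdist-offsets->′ x<N x'<N lt =
      trans (sym (cong₂ (cwdist N) (at-offset x<N) (at-offset x'<N))) (cwdist-offsets-> N s _ _ s<N lt (offset-< _))

    m = offset u₁

    m<n : m < n
    m<n = ≤∧≢⇒< (≤-pred (subst (m <_) (sym n+1≡N) (offset-< u₁)))
                 (λ m≡n → u₀≢u₁ (offset-cancel u₀<N u₁<N (trans offset-u₀ (sym m≡n))))

    side : ℕ → Bool
    side x = does (offset x ≤? m)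

    side-bond : ∀ q → Bond π q → side q ≡ side (suc q)
    side-bond q bond = does-⇔ (mk⇔ (λ le → subst (_≤ m) (sym offset-next) (≤∧≢⇒< le (λ eq → q≢u₁ (offset-cancel q<N u₁<N eq))))
                                    (λ le → <⇒≤ (subst (_≤ m) offset-next le)))
                              (offset q ≤? m) (offset (suc q) ≤? m)
      where
      q<N = <-trans (n<1+n q) (proj₁ bond)
      q≢u₁ : q ≢ u₁
      q≢u₁ refl = nicks u₁ u₁<N unc₁ bond
      offset-q<n : offset q < n
      offset-q<n = ≤∧≢⇒< (≤-pred (subst (offset q <_) (sym n+1≡N) (offset-< q)))
                         (λ eq → nicks u₀ u₀<N unc₀ (subst (Bond π) (offset-cancel q<N u₀<N (trans eq (sym offset-u₀))) bond))
      offset-q+1<N : offset q + 1 < N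
      offset-q+1<N = subst₂ _<_ (+-comm 1 (offset q)) n+1≡N (s≤s offset-q<n)
      next≡ : suc q ≡ at s (offset q + 1)
      next≡ = begin
        suc q                           ≡⟨ mod'-identity (proj₁ bond) ⟨
        (1 + q) mod' N                  ≡⟨ cong (_mod' N) (+-comm 1 q) ⟩
        (q + 1) mod' N                  ≡⟨ cong (λ z → (z + 1) mod' N) (at-offset q<N) ⟨
        (at s (offset q) + 1) mod' N    ≡⟨ mod'-absorbˡ (s + offset q) 1 N ⟩
        (s + offset q + 1) mod' N       ≡⟨ cong (_mod' N) (+-assoc s (offset q) 1) ⟩
        at s (offset q + 1)             ∎
        where open ≡-Reasoning
      offset-next : offset (suc q) ≡ suc (offset q)
      offset-next = trans (cong offset next≡) (trans (cwdist-offset N s (offset q + 1) s<N offset-q+1<N) (+-comm (offset q) 1))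

    side-shortPair : ∀ {k l} → S k l ≡ true → 2 * cwdist N k l ≤ N → side k ≡ side l
    side-shortPair {k} {l} e short = does-⇔ (mk⇔
      (λ k≤m → ≮⇒≥ λ m<l → unc₁ k l e (short , subst₂ _<_ (sym (cwdist-offsets-≤′ k<N u₁<N k≤m))
                                                        (sym (cwdist-offsets-≤′ k<N l<N (<⇒≤ (≤-<-trans k≤m m<l))))
                                                        (∸-monoˡ-< m<l k≤m)))
      (λ l≤m → ≮⇒≥ λ m<k → unc₀ k l e (short , subst₂ _<_ (sym (trans (cwdist-offsets-≤′ k<N u₀<N (subst (offset k ≤_) (sym offset-u₀) (k≤n))) (cong (_∸ offset k) offset-u₀)))
                                                        (sym (cwdist-offsets->′ k<N l<N (≤-<-trans l≤m m<k)))
                                                        (∸-monoˡ-< (≤-trans n<N (m≤m+n N (offset l))) k≤n))))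
      (offset k ≤? m) (offset l ≤? m)
      where
      k<N = pair-<₁ e
      l<N = pair-<₂ e
      k≤n : offset k ≤ n
      k≤n = ≤-pred (subst (offset k <_) (sym n+1≡N) (offset-< k))

    side-pair : ∀ k l → S k l ≡ true → side k ≡ side l
    side-pair k l e with cwdist-short-either N k l (pair-<₁ e) (pair-<₂ e) (pair-≢ e)
    ... | inj₁ short = side-shortPair e short
    ... | inj₂ short = sym (side-shortPair (symm k l e) short)

    side-reach : ∀ {x} → Reach π S 0 x → side 0 ≡ side x
    side-reach here = refl
    side-reach (step r (inj₁ (bond , refl)))        = trans (side-reach r) (side-bond _ bond)
    side-reach (step r (inj₂ (inj₁ (bond , refl)))) = trans (side-reach r) (sym (side-bond _ bond))
    side-reach (step r (inj₂ (inj₂ e)))             = trans (side-reach r) (side-pair _ _ e)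

    disconnected : ¬ Connected π S
    disconnected connected = contradiction (trans (sym (side-reach (connected u₀ u₀<N))) (side-reach (connected u₁ u₁<N)))
      (λ eq → false≢true (trans side-u₀ (trans eq (dec-true (m ≤? m) ≤-refl))))
      where
      false≢true : false ≢ true
      false≢true ()
      side-u₀ : false ≡ side u₀
      side-u₀ = sym (dec-false (offset u₀ ≤? m) (<⇒≱ (subst (m <_) (sym offset-u₀) m<n)))

-- Admissible symmetric backbone cuts

module SymmetricStructure (y : Ordering) (v : ℕ) {{_ : NonZero v}} (ne : NonEmptyStrands y) (y≢[] : y ≢ [])
  (S : Structure) (ss : IsSecStruct (rep v y) S) (U : Unpseudoknotted S) (connected : Connected (rep v y) S)
  (2≤R : 2 ≤ symDeg (rep v y) y v S) where

  0<L : 0 < nBases y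
  0<L = nBases-positive y ne y≢[]

  instance
    L≢0 : NonZero (nBases y)
    L≢0 = >-nonZero 0<L

  open Rotations y v 0<L public
  open Planar π S ss U public hiding (N)
  open IsSecStruct ss
  open Generator (generator S 2≤R) public

  R = symDeg π y v S

  instance
    g≢0 : NonZero g
    g≢0 = >-nonZero 0<g

  g<v : g < v
  g<v = subst (g <_) g*R≡v (subst (_< g * R) (*-identityʳ g) (*-monoʳ-< g 2≤R))

  g∣v : g ∣ v
  g∣v = divides R (trans (sym g*R≡v) (*-comm g R))

  N≡R*gL : N ≡ R * (g * L)
  N≡R*gL = trans N≡v*L (trans (cong (_* L) (trans (sym g*R≡v) (*-comm g R))) (*-assoc R g L))

  gL<N : g * L < N
  gL<N = subst (g * L <_) (sym N≡v*L) (*-monoˡ-< L g<v)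

  0<gL : 0 < g * L
  0<gL = *-mono-< {0} {g} {0} {L} 0<g 0<L

  invariant-g : Invariant S g
  invariant-g = invariant-∣ g ∣-refl

  uncovered-rotate : ∀ k → k ≤ v → Invariant S k → ∀ {p} → p < N → Uncovered p → Uncovered (rotate k p)
  uncovered-rotate k k≤v inv {p} p<N unc i j e (short , cov) = unc i' j' e' (subst (λ d → 2 * d ≤ N) d-ij short , subst₂ _<_ d-ip d-ij cov)
    where
    i<N = pair-<₁ e
    j<N = pair-<₂ e
    i' = rotate (v ∸ k) i
    j' = rotate (v ∸ k) j
    back : ∀ {x} → x < N → rotate k (rotate (v ∸ k) x) ≡ x
    back = rotate-inverse k k≤v
    e' : S i' j' ≡ true
    e' = trans (inv i' j' (rotate-< (v ∸ k) i) (rotate-< (v ∸ k) j)) (trans (cong₂ S (back i<N) (back j<N)) e)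
    d-ij : cwdist N i j ≡ cwdist N i' j'
    d-ij = trans (sym (cong₂ (cwdist N) (back i<N) (back j<N))) (cwdist-rotate k (rotate-< (v ∸ k) i) (rotate-< (v ∸ k) j))
    d-ip : cwdist N i (rotate k p) ≡ cwdist N i' p
    d-ip = trans (sym (cong (λ z → cwdist N z (rotate k p)) (back i<N))) (cwdist-rotate k (rotate-< (v ∸ k) i) p<N)

  halfTurn-noDiameter : 2 ≡ R → NoDiameter
  halfTurn-noDiameter 2≡R i j e 2d≡N with compl i j e
  ... | b , b' , bi , bj , c = ¬self-complementary (subst (Compl b) (just-injective same) c)
    where
    ¬self-complementary : ∀ {b} → ¬ Compl b b
    ¬self-complementary ()
    i<N = pair-<₁ e
    d≡gL : cwdist N i j ≡ g * L
    d≡gL = *-cancelˡ-≡ _ _ 2 (trans 2d≡N (subst (λ r → N ≡ r * (g * L)) (sym 2≡R) N≡R*gL))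
    j≡ : j ≡ rotate g i
    j≡ = trans (as-offset N i j i<N (pair-<₂ e)) (cong (at i) d≡gL)
    same : just b' ≡ just b
    same = trans (sym bj) (trans (cong (nth (bases π)) j≡) (trans (nth-bases-rotate g i<N) bi))

  smallRotation-noDiameter : 3 ≤ R → NoDiameter
  smallRotation-noDiameter 3≤R i j e 2d≡N =
    noCrossingFrom S symm U N i (g * L) d (d + g * L) i<N 0<gL gL<d (m<m+n d 0<gL) d+gL<N
      (subst (λ z → S i z ≡ true) (as-offset N i j i<N (pair-<₂ e)) e) rotated
    where
    i<N = pair-<₁ e
    d = cwdist N i j
    gL<d : g * L < d
    gL<d = *-cancelˡ-< 2 (g * L) d (begin-strict
      2 * (g * L)        <⟨ m<n+m (2 * (g * L)) 0<gL ⟩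
      3 * (g * L)        ≤⟨ *-monoˡ-≤ (g * L) 3≤R ⟩
      R * (g * L)        ≡⟨ N≡R*gL ⟨
      N                  ≡⟨ 2d≡N ⟨
      2 * d              ∎)
      where open ≤-Reasoning
    d+gL<N : d + g * L < N
    d+gL<N = subst (d + g * L <_) (trans (cong (d +_) (sym (+-identityʳ d))) 2d≡N) (+-monoʳ-< d gL<d)
    rotated : S (at i (g * L)) (at i (d + g * L)) ≡ true
    rotated = trans (cong (S (rotate g i)) j+gL≡) (trans (sym (invariant-g i j i<N (pair-<₂ e))) e)
      where
      j+gL≡ : at i (d + g * L) ≡ rotate g j
      j+gL≡ = trans (cong (_mod' N) (sym (+-assoc i d (g * L))))
                    (trans (sym (mod'-absorbˡ (i + d) (g * L) N)) (cong (λ z → (z + g * L) mod' N) (sym (as-offset N i j i<N (pair-<₂ e)))))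

  -- A diameter is fixed by the half-turn when R = 2, so it would pair a base with an identical one;
  -- when R ≥ 3 the rotation by g moves it by at most a third of the circle, onto a crossing pair.
  noDiameter : NoDiameter
  noDiameter with m≤n⇒m<n∨m≡n 2≤R
  ... | inj₂ 2≡R = halfTurn-noDiameter 2≡R
  ... | inj₁ 3≤R = smallRotation-noDiameter 3≤R

  rotate-g-≢ : ∀ {u} → u < N → u ≢ rotate g u
  rotate-g-≢ {u} u<N eq = <-irrefl (offset-injective N u 0 (g * L) u<N 0<N gL<N (trans (mod'-+0 u<N) eq)) 0<gL

  -- Were every uncovered position a nick, an uncovered u and its rotation by g would disconnect S.
  ¬¬-uncoveredBond : ¬ ¬ (Σ[ u ∈ ℕ ] u < N × Bond π u × Uncovered u)
  ¬¬-uncoveredBond ¬bond = ¬¬-uncovered 0<N noDiameter λ (u , u<N , unc) →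
    Separation.disconnected (λ p p<N unc bond → ¬bond (p , p<N , bond , unc)) u<N (rotate-< g u) (rotate-g-≢ u<N) unc
      (uncovered-rotate g (<⇒≤ g<v) invariant-g u<N unc) connected

  instance
    R≢0 : NonZero R
    R≢0 = >-nonZero (≤-trans (s≤s z≤n) 2≤R)

    gL≢0 : NonZero (g * L)
    gL≢0 = >-nonZero 0<gL

  admissible : ∀ {b} → b < N → Bond π b → Uncovered b → Admissible π y v S R b
  admissible {b} b<N bond unc = bond , λ where
    p (k , k<v , v∣kR , refl) i j e arc →
      uncovered-rotate k (<⇒≤ k<v) (invariant-∣ k (*-cancelʳ-∣ R (subst (_∣ k * R) (sym g*R≡v) v∣kR))) b<N unc i j e arc

  -- Rotating by a multiple of g moves an uncovered bond into the first g copies of y.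
  uncoveredBond-first : ∀ {u} → u < N → Bond π u → Uncovered u → Σ[ b ∈ ℕ ] b < g * L × Bond π b × Uncovered b
  uncoveredBond-first {u} u<N bond unc = b , m%n<n u (g * L) , bond-b , subst Uncovered rotate-k≡b (uncovered-rotate k k≤v inv-k u<N unc)
    where
    open Repetition y using (bond⇒joined-%; joined-%⇒bond)
    b = u % (g * L)
    q = u / (g * L)
    k = v ∸ q * g
    k≤v = m∸n≤m v (q * g)
    b<N = <-trans (m%n<n u (g * L)) gL<N
    q*g≤v : q * g ≤ v
    q*g≤v = subst (q * g ≤_) (trans (*-comm R g) g*R≡v) (*-monoˡ-≤ g (<⇒≤ (m<n*o⇒m/o<n {u} {R} {g * L} (subst (u <_) N≡R*gL u<N))))
    inv-k : Invariant S k
    inv-k = invariant-∣ k (∣m+n∣m⇒∣n (subst (g ∣_) (sym (m+[n∸m]≡n q*g≤v)) g∣v) (n∣m*n q))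
    rotate-k≡b : rotate k u ≡ b
    rotate-k≡b = begin
      (u + k * L) mod' N                 ≡⟨ cong (λ z → (z + k * L) mod' N) (m≡m%n+[m/n]*n u (g * L)) ⟩
      (b + q * (g * L) + k * L) mod' N   ≡⟨ cong (_mod' N) (+-assoc b _ _) ⟩
      (b + (q * (g * L) + k * L)) mod' N ≡⟨ cong (λ z → (b + z) mod' N) full-turn ⟩
      (b + N) mod' N                     ≡⟨ mod'-+N b N ⟩
      b mod' N                           ≡⟨ mod'-identity b<N ⟩
      b                                  ∎
      where
      open ≡-Reasoning
      full-turn : q * (g * L) + k * L ≡ N
      full-turn = begin
        q * (g * L) + k * L    ≡⟨ cong (_+ k * L) (*-assoc q g L) ⟨
        q * g * L + k * L      ≡⟨ *-distribʳ-+ L (q * g) k ⟨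
        (q * g + k) * L        ≡⟨ cong (_* L) (m+[n∸m]≡n q*g≤v) ⟩
        v * L                  ≡⟨ N≡v*L ⟨
        N                      ∎
    bond-b : Bond π b
    bond-b = joined-%⇒bond v b b<N (subst (Joined (labels y 0)) (sym (m∣n⇒o%n%m≡o%m L (g * L) u (n∣m*n g))) (bond⇒joined-% v ne y≢[] u bond))

-- Complementary pairs of positions

partner : Base → Base
partner A = T
partner T = A
partner C = G
partner G = C

isᵇ : Base → Maybe Base → Bool
isᵇ A (just A) = true
isᵇ T (just T) = true
isᵇ C (just C) = true
isᵇ G (just G) = true
isᵇ _ _        = false

complementaryᵇ : Maybe Base → Maybe Base → Bool
complementaryᵇ m (just y) = isᵇ (partner y) m
complementaryᵇ m nothing  = false

paired⇒complementaryᵇ : ∀ {m n} → Σ[ x ∈ Base ] Σ[ y ∈ Base ] (m ≡ just x × n ≡ just y × Compl x y) →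
  complementaryᵇ n m ≡ true
paired⇒complementaryᵇ (_ , _ , refl , refl , AT) = refl
paired⇒complementaryᵇ (_ , _ , refl , refl , TA) = refl
paired⇒complementaryᵇ (_ , _ , refl , refl , CG) = refl
paired⇒complementaryᵇ (_ , _ , refl , refl , GC) = refl

module _ (bs : ℕ → Maybe Base) where

  count : Base → ℕ → ℕ
  count X n = Σ< n (λ u → 𝟙 (isᵇ X (bs u)))

  complementaryPairs : ℕ → ℕ
  complementaryPairs n = Σ< n (λ w → Σ< w (λ u → 𝟙 (complementaryᵇ (bs u) (bs w))))

  complementaryPairs≡ : ∀ n → complementaryPairs n ≡ count A n * count T n + count C n * count G n
  complementaryPairs≡ zero    = refl
  complementaryPairs≡ (suc n) = trans (cong (_+ partners (bs n)) (complementaryPairs≡ n)) (addPosition (bs n))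
    where
    a = count A n
    t = count T n
    c = count C n
    g = count G n
    partners : Maybe Base → ℕ
    partners m = Σ< n (λ u → 𝟙 (complementaryᵇ (bs u) m))
    addPosition : ∀ m → a * t + c * g + partners m
               ≡ (a + 𝟙 (isᵇ A m)) * (t + 𝟙 (isᵇ T m)) + (c + 𝟙 (isᵇ C m)) * (g + 𝟙 (isᵇ G m))
    addPosition (just A) = solve 4 (λ a t c g → a :* t :+ c :* g :+ t := (a :+ con 1) :* (t :+ con 0) :+ (c :+ con 0) :* (g :+ con 0)) refl a t c g
    addPosition (just T) = solve 4 (λ a t c g → a :* t :+ c :* g :+ a := (a :+ con 0) :* (t :+ con 1) :+ (c :+ con 0) :* (g :+ con 0)) refl a t c g
    addPosition (just C) = solve 4 (λ a t c g → a :* t :+ c :* g :+ g := (a :+ con 0) :* (t :+ con 0) :+ (c :+ con 1) :* (g :+ con 0)) refl a t c g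
    addPosition (just G) = solve 4 (λ a t c g → a :* t :+ c :* g :+ c := (a :+ con 0) :* (t :+ con 0) :+ (c :+ con 0) :* (g :+ con 1)) refl a t c g
    addPosition nothing  = trans (cong (a * t + c * g +_) (Σ<-zero n (λ _ _ → refl))) $ solve 4 (λ a t c g → a :* t :+ c :* g :+ con 0 := (a :+ con 0) :* (t :+ con 0) :+ (c :+ con 0) :* (g :+ con 0)) refl a t c g

  count-total : ∀ n → count A n + count T n + (count C n + count G n) ≤ n
  count-total zero    = z≤n
  count-total (suc n) = subst₂ _≤_ (sym (regroup (bs n))) (+-comm n 1) (+-mono-≤ (count-total n) (atMostOne (bs n)))
    where
    one : Maybe Base → ℕ
    one m = 𝟙 (isᵇ A m) + 𝟙 (isᵇ T m) + (𝟙 (isᵇ C m) + 𝟙 (isᵇ G m))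
    atMostOne : ∀ m → one m ≤ 1
    atMostOne (just A) = ≤-refl
    atMostOne (just T) = ≤-refl
    atMostOne (just C) = ≤-refl
    atMostOne (just G) = ≤-refl
    atMostOne nothing  = z≤n
    regroup : ∀ m → (count A n + 𝟙 (isᵇ A m)) + (count T n + 𝟙 (isᵇ T m)) + ((count C n + 𝟙 (isᵇ C m)) + (count G n + 𝟙 (isᵇ G m)))
                  ≡ count A n + count T n + (count C n + count G n) + one m
    regroup m = solve 8 (λ a t c g x y z q → (a :+ x) :+ (t :+ y) :+ ((c :+ z) :+ (g :+ q)) := a :+ t :+ (c :+ g) :+ (x :+ y :+ (z :+ q)))
                        refl (count A n) (count T n) (count C n) (count G n) (𝟙 (isᵇ A m)) (𝟙 (isᵇ T m)) (𝟙 (isᵇ C m)) (𝟙 (isᵇ G m))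

4xy≤[x+y]²-ordered : ∀ {x y} → x ≤ y → 4 * (x * y) ≤ (x + y) * (x + y)
4xy≤[x+y]²-ordered {x} {y} x≤y = subst₂ (λ p q → 4 * (x * p) ≤ (x + p) * (x + p)) (m+[n∸m]≡n x≤y) (m+[n∸m]≡n x≤y)
                      (subst (4 * (x * (x + (y ∸ x))) ≤_) (sym (square x (y ∸ x))) (m≤m+n _ ((y ∸ x) * (y ∸ x))))
  where
  square : ∀ x k → (x + (x + k)) * (x + (x + k)) ≡ 4 * (x * (x + k)) + k * k
  square = solve 2 (λ x k → (x :+ (x :+ k)) :* (x :+ (x :+ k)) := con 4 :* (x :* (x :+ k)) :+ k :* k) refl

4xy≤[x+y]² : ∀ x y → 4 * (x * y) ≤ (x + y) * (x + y)
4xy≤[x+y]² x y with ≤-total x y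
... | inj₁ x≤y = 4xy≤[x+y]²-ordered x≤y
... | inj₂ y≤x = subst₂ (λ p q → 4 * p ≤ q * q) (*-comm y x) (+-comm y x) (4xy≤[x+y]²-ordered y≤x)

x²+y²≤[x+y]² : ∀ x y → x * x + y * y ≤ (x + y) * (x + y)
x²+y²≤[x+y]² x y = subst (x * x + y * y ≤_) (sym (expand x y)) (m≤m+n _ (2 * (x * y)))
  where
  expand : ∀ x y → (x + y) * (x + y) ≡ x * x + y * y + 2 * (x * y)
  expand = solve 2 (λ x y → (x :+ y) :* (x :+ y) := x :* x :+ y :* y :+ con 2 :* (x :* y)) refl

4*complementaryPairs≤n² : ∀ bs n → 4 * complementaryPairs bs n ≤ n * n
4*complementaryPairs≤n² bs n = begin
  4 * complementaryPairs bs n                    ≡⟨ cong (4 *_) (complementaryPairs≡ bs n) ⟩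
  4 * (a * t + c * g)                            ≡⟨ *-distribˡ-+ 4 (a * t) (c * g) ⟩
  4 * (a * t) + 4 * (c * g)                      ≤⟨ +-mono-≤ (4xy≤[x+y]² a t) (4xy≤[x+y]² c g) ⟩
  (a + t) * (a + t) + (c + g) * (c + g)          ≤⟨ x²+y²≤[x+y]² (a + t) (c + g) ⟩
  (a + t + (c + g)) * (a + t + (c + g))          ≤⟨ *-mono-≤ (count-total bs n) (count-total bs n) ⟩
  n * n                                          ∎
  where
  open ≤-Reasoning
  a = count bs A n
  t = count bs T n
  c = count bs C n
  g = count bs G n

-- Central internal loops

module HalfTurnSymmetric (y : Ordering) (v : ℕ) {{_ : NonZero v}} (ne : NonEmptyStrands y) (y≢[] : y ≢ [])
  (S : Structure) (ss : IsSecStruct (rep v y) S) (U : Unpseudoknotted S) (connected : Connected (rep v y) S)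
  (R≡2 : symDeg (rep v y) y v S ≡ 2) where

  open SymmetricStructure y v ne y≢[] S ss U connected (≤-reflexive (sym R≡2)) public
  open IsSecStruct ss

  h = half π

  h≡gL : h ≡ g * L
  h≡gL = trans (cong (_/ 2) N≡2*gL) (m*n/n≡m (g * L) 2)
    where
    N≡2*gL : N ≡ g * L * 2
    N≡2*gL = trans N≡R*gL (trans (cong (_* (g * L)) R≡2) (*-comm 2 (g * L)))

  N≡h+h : N ≡ h + h
  N≡h+h = trans N≡R*gL (trans (cong (_* (g * L)) R≡2) (trans (cong (λ z → z + (z + 0)) (sym h≡gL)) (cong (h +_) (+-identityʳ h))))

  0<h : 0 < h
  0<h = subst (0 <_) (sym h≡gL) 0<gL

  h<N : h < N
  h<N = subst (h <_) (sym N≡h+h) (m<m+n h 0<h)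

  at-h≡rotate : ∀ p → at p h ≡ rotate g p
  at-h≡rotate p = cong (λ z → (p + z) mod' N) h≡gL

  at-h-at-h : ∀ {p} → p < N → at (at p h) h ≡ p
  at-h-at-h {p} p<N = begin
    at (at p h) h        ≡⟨ mod'-absorbˡ (p + h) h N ⟩
    (p + h + h) mod' N   ≡⟨ cong (_mod' N) (trans (+-assoc p h h) (cong (p +_) (sym N≡h+h))) ⟩
    (p + N) mod' N       ≡⟨ mod'-+N p N ⟩
    p mod' N             ≡⟨ mod'-identity p<N ⟩
    p                    ∎
    where open ≡-Reasoning

  long-backwards : ∀ {s i j} → s < N → cwdist N s j < cwdist N s i → cwdist N s i < cwdist N s j + h →
    S i j ≡ true → ¬ 2 * cwdist N i j ≤ N
  long-backwards {s} {i} {j} s<N oj<oi oi<oj+h e short = <-irrefl refl (<-≤-trans (+-mono-< h<D h<D) (subst₂ _≤_ (twice D) N≡h+h short))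
    where
    oi = cwdist N s i
    oj = cwdist N s j
    D = cwdist N i j
    D≡ : D ≡ N + oj ∸ oi
    D≡ = trans (cong₂ (cwdist N) (as-offset N s i s<N (pair-<₁ e)) (as-offset N s j s<N (pair-<₂ e)))
               (cwdist-offsets-> N s oi oj s<N oj<oi (cwdist-< N s i 0<N))
    D+oi≡N+oj : D + oi ≡ N + oj
    D+oi≡N+oj = trans (cong (_+ oi) D≡) (m∸n+n≡m (≤-trans (<⇒≤ (cwdist-< N s i 0<N)) (m≤m+n N oj)))
    h<D : h < D
    h<D = +-cancelʳ-< h h D (subst (_< D + h) N≡h+h (+-cancelʳ-< oj N (D + h) (begin-strict
      N + oj            ≡⟨ D+oi≡N+oj ⟨
      D + oi            <⟨ +-monoʳ-< D oi<oj+h ⟩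
      D + (oj + h)      ≡⟨ cong (D +_) (+-comm oj h) ⟩
      D + (h + oj)      ≡⟨ +-assoc D h oj ⟨
      D + h + oj        ∎)))
      where open ≤-Reasoning

  module Loop {a b : ℕ} (c : CentralInternalLoop π S a b) where

    pair-ab : S a b ≡ true
    pair-ab = proj₁ c

    pair-ab+h : S (at a h) (at b h) ≡ true
    pair-ab+h = proj₁ (proj₂ c)

    d = cwdist N a b
    gap = h ∸ d

    d<h : d < h
    d<h = proj₁ (proj₂ (proj₂ (proj₂ c)))

    unpaired : ∀ t → 0 < t → t < gap → Unpaired S (at b t) × Unpaired S ((b + h + t) mod' N)
    unpaired = proj₁ (proj₂ (proj₂ (proj₂ (proj₂ c))))

    bonds : ∀ t → t < gap → Bond π (at b t) × Bond π ((b + h + t) mod' N)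
    bonds = proj₂ (proj₂ (proj₂ (proj₂ (proj₂ c))))

    a<N : a < N
    a<N = pair-<₁ pair-ab

    b<N : b < N
    b<N = pair-<₂ pair-ab

    0<gap : 0 < gap
    0<gap = m<n⇒0<n∸m d<h

    d+gap≡h : d + gap ≡ h
    d+gap≡h = m+[n∸m]≡n (<⇒≤ d<h)

    b≡ : b ≡ at a d
    b≡ = as-offset N a b a<N b<N

    at-b-gap : at b gap ≡ at a h
    at-b-gap = trans (cong (λ z → at z gap) b≡) (trans (mod'-absorbˡ (a + d) gap N) (cong (_mod' N) (trans (+-assoc a d gap) (cong (a +_) d+gap≡h))))

    h<cwdist-ba : h < cwdist N b a
    h<cwdist-ba = +-cancelʳ-< d h _ (begin-strict
      h + d                 <⟨ +-monoʳ-< h d<h ⟩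
      h + h                 ≡⟨ N≡h+h ⟨
      N                     ≡⟨ cwdist-+-cwdist N a b a<N b<N (pair-≢ pair-ab) ⟨
      d + cwdist N b a      ≡⟨ +-comm d _ ⟩
      cwdist N b a + d      ∎)
      where open ≤-Reasoning

    at-b : ∀ t → at b t ≡ at a (d + t)
    at-b t = trans (cong (λ z → at z t) b≡) (trans (mod'-absorbˡ (a + d) t N) (cong (_mod' N) (+-assoc a d t)))

    at-b+h : ∀ t → (b + h + t) mod' N ≡ at a (h + (d + t))
    at-b+h t = trans (cong (_mod' N) (+-assoc b h t)) (trans (at-b (h + t)) (cong (at a) (x∙yz≈y∙xz d h t)))

    module CoveringB {i j : ℕ} (e : S i j ≡ true) (short : 2 * cwdist N i j ≤ N) where

      oi = cwdist N b i
      oj = cwdist N b j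
      i<N = pair-<₁ e
      j<N = pair-<₂ e
      i≡ = as-offset N b i b<N i<N
      j≡ = as-offset N b j b<N j<N
      oi<N = cwdist-< N b i 0<N
      oj<N = cwdist-< N b j 0<N

      from-b : oi ≢ 0
      from-b oi≡0 = <-irrefl refl (<-≤-trans (+-mono-< h<cwdist-ba h<cwdist-ba)
                                             (subst (λ D → D + D ≤ h + h) D≡ (subst₂ _≤_ (twice (cwdist N i j)) N≡h+h short)))
        where
        i≡b = cwdist≡0⇒≡ N b i b<N i<N oi≡0
        D≡ : cwdist N i j ≡ cwdist N b a
        D≡ = cong₂ (cwdist N) i≡b (sym (pair-unique (subst (λ z → S z j ≡ true) i≡b e) pair-ab))

      forwards : 0 < oi → oi < oj → ¬ cwdist N i b < cwdist N i j
      forwards 0<oi oi<oj cov = <-irrefl refl (<-trans cov (begin-strict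
        cwdist N i j              ≡⟨ cong₂ (cwdist N) i≡ j≡ ⟩
        cwdist N (at b oi) (at b oj) ≡⟨ cwdist-offsets-≤ N b oi oj b<N (<⇒≤ oi<oj) oj<N ⟩
        oj ∸ oi                   <⟨ ∸-monoˡ-< (≤-trans oj<N (m≤m+n N 0)) (<⇒≤ oi<oj) ⟩
        N + 0 ∸ oi                ≡⟨ cwdist-offsets-> N b oi 0 b<N 0<oi oi<N ⟨
        cwdist N (at b oi) (at b 0) ≡⟨ cong₂ (cwdist N) i≡ (sym (mod'-+0 b<N)) ⟨
        cwdist N i b              ∎))
        where open ≤-Reasoning

      at-a+h : oj ≡ gap → oj < oi → ⊥
      at-a+h oj≡gap oj<oi = long-backwards b<N oj<oi (subst (_< oj + h) (sym oi≡h) (subst (h <_) (+-comm h oj) (m<m+n h (subst (0 <_) (sym oj≡gap) 0<gap)))) e short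
        where
        j≡a+h : j ≡ at a h
        j≡a+h = trans j≡ (trans (cong (at b) oj≡gap) at-b-gap)
        i≡b+h : i ≡ at b h
        i≡b+h = pair-unique (subst (λ z → S z (at b h) ≡ true) (sym j≡a+h) pair-ab+h) e
        oi≡h : oi ≡ h
        oi≡h = trans (cong (cwdist N b) i≡b+h) (cwdist-offset N b h b<N h<N)

      beyond-gap : gap < oj → oj < oi → ⊥
      beyond-gap gap<oj oj<oi with oi <? oj + h
      ... | yes oi<oj+h = long-backwards b<N oj<oi oi<oj+h e short
      ... | no oi≮oj+h = noCrossing S symm U N b gap oj h oi b<N gap<oj oj<h h<oi oi<N
                          (subst (λ z → S z (at b h) ≡ true) (sym at-b-gap) pair-ab+h)
                          (subst₂ (λ p q → S p q ≡ true) j≡ i≡ (symm i j e))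
        where
        oj+h≤oi = ≮⇒≥ oi≮oj+h
        oj<h : oj < h
        oj<h = +-cancelʳ-< h oj h (<-≤-trans (≤-<-trans oj+h≤oi oi<N) (≤-reflexive N≡h+h))
        h<oi : h < oi
        h<oi = <-≤-trans (subst (h <_) (+-comm h oj) (m<m+n h (<-trans 0<gap gap<oj))) oj+h≤oi

    -- Read from b, a short pair whose arc contains b must end inside the loop (where bases are
    -- unpaired), at a + h (forcing the long pair (b + h, a + h)), or cross the pair (a + h, b + h).
    uncovered-b : Uncovered b
    uncovered-b i j e (short , cov) with cwdist N b i ≟ 0
    ... | yes oi≡0 = from-b oi≡0
      where open CoveringB e short
    ... | no oi≢0 with <-cmp (cwdist N b i) (cwdist N b j)
    ...   | tri< oi<oj _ _ = CoveringB.forwards e short (n≢0⇒n>0 oi≢0) oi<oj cov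
    ...   | tri≈ _ oi≡oj _ = pair-≢ e (trans (CoveringB.i≡ e short) (trans (cong (at b) oi≡oj) (sym (CoveringB.j≡ e short))))
    ...   | tri> _ _ oj<oi with cwdist N b j ≟ 0 | <-cmp (cwdist N b j) gap
    ...     | yes oj≡0 | _ = <-irrefl (cong (cwdist N i) (sym (cwdist≡0⇒≡ N b j b<N (pair-<₂ e) oj≡0))) cov
    ...     | no oj≢0 | tri< oj<gap _ _ = contradiction (trans (sym (subst (λ z → S z i ≡ true) (CoveringB.j≡ e short) (symm i j e)))
                                                           (proj₁ (unpaired _ (n≢0⇒n>0 oj≢0) oj<gap) i)) (λ ())
    ...     | no _ | tri≈ _ oj≡gap _ = CoveringB.at-a+h e short oj≡gap oj<oi
    ...     | no _ | tri> _ _ gap<oj = CoveringB.beyond-gap e short gap<oj oj<oi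

  unpaired-⊥ : ∀ {q r} → Unpaired S q → S q r ≡ true → ⊥
  unpaired-⊥ {q} {r} unp e = contradiction (trans (sym e) (unp r)) (λ ())

  -- Positions are measured clockwise from x.
  module Enclosure {x z a' b' : ℕ} (exz : S x z ≡ true) (d<h : cwdist N x z < h)
    (0<o : 0 < cwdist N x a') (o<d : cwdist N x a' < cwdist N x z) (c' : CentralInternalLoop π S a' b') where

    module L' = Loop c'
    x<N = pair-<₁ exz
    o = cwdist N x a'
    ob = cwdist N x b'
    d = cwdist N x z
    a'≡ = as-offset N x a' x<N L'.a<N
    b'≡ = as-offset N x b' x<N L'.b<N
    z≡ = as-offset N x z x<N (pair-<₂ exz)

    b'-not-before-a' : ¬ ob < o
    b'-not-before-a' ob<o = <-irrefl refl (<-trans L'.d<h h<d')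
      where
      d'≡ : L'.d ≡ N + ob ∸ o
      d'≡ = trans (cong₂ (cwdist N) a'≡ b'≡) (cwdist-offsets-> N x o ob x<N ob<o (cwdist-< N x a' 0<N))
      h<d' : h < L'.d
      h<d' = +-cancelʳ-< o h L'.d (begin-strict
        h + o            <⟨ +-monoʳ-< h (<-trans o<d d<h) ⟩
        h + h            ≡⟨ N≡h+h ⟨
        N                ≤⟨ m≤m+n N ob ⟩
        N + ob           ≡⟨ m∸n+n≡m (≤-trans (<⇒≤ (cwdist-< N x a' 0<N)) (m≤m+n N ob)) ⟨
        N + ob ∸ o + o   ≡⟨ cong (_+ o) d'≡ ⟨
        L'.d + o         ∎)
        where open ≤-Reasoning

    b'-not-a' : ob ≢ o
    b'-not-a' ob≡o = pair-≢ L'.pair-ab (trans a'≡ (trans (cong (at x) (sym ob≡o)) (sym b'≡)))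

    -- z would lie on the unpaired stretch after b'.
    b'-not-within : o < ob → ¬ ob < d
    b'-not-within o<ob ob<d = unpaired-⊥ (subst (Unpaired S) at-b'≡z (proj₁ (L'.unpaired (d ∸ ob) (m<n⇒0<n∸m ob<d) inLoop))) (symm x z exz)
      where
      d'≡ : L'.d ≡ ob ∸ o
      d'≡ = trans (cong₂ (cwdist N) a'≡ b'≡) (cwdist-offsets-≤ N x o ob x<N (<⇒≤ o<ob) (cwdist-< N x b' 0<N))
      inLoop : d ∸ ob < L'.gap
      inLoop = subst (d ∸ ob <_) (cong (h ∸_) (sym d'≡)) (+-cancelʳ-< (ob ∸ o) (d ∸ ob) (h ∸ (ob ∸ o)) (begin-strict
        d ∸ ob + (ob ∸ o)         ≡⟨ +-comm (d ∸ ob) (ob ∸ o) ⟩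
        ob ∸ o + (d ∸ ob)         ≡⟨ ∸-+-∸ (<⇒≤ o<ob) (<⇒≤ ob<d) ⟩
        d ∸ o                     ≤⟨ m∸n≤m d o ⟩
        d                         <⟨ d<h ⟩
        h                         ≡⟨ m∸n+n≡m (subst (_≤ h) d'≡ (<⇒≤ L'.d<h)) ⟨
        h ∸ (ob ∸ o) + (ob ∸ o)   ∎))
        where open ≤-Reasoning
      at-b'≡z : at b' (d ∸ ob) ≡ z
      at-b'≡z = trans (cong (λ q → at q (d ∸ ob)) b'≡) (trans (offset-rebase N x ob d (<⇒≤ ob<d)) (sym z≡))

    b'-not-z : ob ≢ d
    b'-not-z ob≡d = <-irrefl (sym o≡0) 0<o
      where
      b'≡z : b' ≡ z
      b'≡z = trans b'≡ (trans (cong (at x) ob≡d) (sym z≡))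
      x≡a' : x ≡ a'
      x≡a' = atMostOne z x a' (symm x z exz) (subst (λ q → S q a' ≡ true) b'≡z (symm a' b' L'.pair-ab))
      o≡0 : o ≡ 0
      o≡0 = trans (cong (cwdist N x) (sym x≡a')) (cwdist-self N x x<N)

    b'-not-beyond : ¬ d < ob
    b'-not-beyond d<ob = noCrossingFrom S symm U N x o d ob x<N 0<o o<d d<ob (cwdist-< N x b' 0<N)
                           (subst (λ q → S x q ≡ true) z≡ exz) (subst₂ (λ p q → S p q ≡ true) a'≡ b'≡ L'.pair-ab)

  -- The loop's pair (a', b') would cross (x, z), or b' would lie before a' making the loop too long,
  -- or z would lie on an unpaired stretch of the loop.
  ¬enclosing : ∀ {x z a' b'} → S x z ≡ true → cwdist N x z < h → 0 < cwdist N x a' → cwdist N x a' < cwdist N x z →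
    ¬ CentralInternalLoop π S a' b'
  ¬enclosing exz d<h 0<o o<d c' = wherever-b'-lies
    where
    open Enclosure exz d<h 0<o o<d c'
    wherever-b'-lies : ⊥
    wherever-b'-lies with <-cmp ob o | <-cmp ob d
    ... | tri< ob<o _ _ | _              = b'-not-before-a' ob<o
    ... | tri≈ _ ob≡o _ | _              = b'-not-a' ob≡o
    ... | tri> _ _ o<ob | tri< ob<d _ _  = b'-not-within o<ob ob<d
    ... | tri> _ _ _    | tri≈ _ ob≡d _  = b'-not-z ob≡d
    ... | tri> _ _ _    | tri> _ _ d<ob  = b'-not-beyond d<ob

  -- Positions are measured clockwise from a.
  module TwoLoops {a b a' b' : ℕ} (c : CentralInternalLoop π S a b) (c' : CentralInternalLoop π S a' b') where

    module L = Loop c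
    module L' = Loop c'
    d = L.d
    oa = cwdist N a a'
    oa<N = cwdist-< N a a' 0<N
    a'≡ : a' ≡ at a oa
    a'≡ = as-offset N a a' L.a<N L'.a<N

    ¬longer : cwdist N a' b' ≢ cwdist N b a
    ¬longer eq = <-irrefl refl (<-trans L'.d<h (subst (h <_) (sym eq) L.h<cwdist-ba))

    at-a : oa ≡ 0 → SameLoop π a b a' b'
    at-a oa≡0 = inj₁ (a'≡a , atMostOne a b' b (subst (λ z → S z b' ≡ true) a'≡a L'.pair-ab) L.pair-ab)
      where
      a'≡a = cwdist≡0⇒≡ N a a' L.a<N L'.a<N oa≡0

    not-enclosed : 0 < oa → ¬ oa < d
    not-enclosed 0<oa oa<d = ¬enclosing L.pair-ab L.d<h 0<oa oa<d c'

    not-b : oa ≢ d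
    not-b oa≡d = ¬longer (cong₂ (cwdist N) a'≡b b'≡a)
      where
      a'≡b : a' ≡ b
      a'≡b = trans a'≡ (trans (cong (at a) oa≡d) (sym L.b≡))
      b'≡a : b' ≡ a
      b'≡a = atMostOne b b' a (subst (λ z → S z b' ≡ true) a'≡b L'.pair-ab) (symm a b L.pair-ab)

    not-after-b : d < oa → ¬ oa < h
    not-after-b d<oa oa<h = unpaired-⊥ (subst (Unpaired S) at-b≡a' (proj₁ (L.unpaired (oa ∸ d) (m<n⇒0<n∸m d<oa) (∸-monoˡ-< oa<h (<⇒≤ d<oa))))) L'.pair-ab
      where
      at-b≡a' : at b (oa ∸ d) ≡ a'
      at-b≡a' = trans (L.at-b (oa ∸ d)) (trans (cong (at a) (m+[n∸m]≡n (<⇒≤ d<oa))) (sym a'≡))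

    at-a+h : oa ≡ h → SameLoop π a b a' b'
    at-a+h oa≡h = inj₂ (a'≡a+h , atMostOne a' b' (at b h) L'.pair-ab (subst (λ z → S z (at b h) ≡ true) (sym a'≡a+h) L.pair-ab+h))
      where
      a'≡a+h : a' ≡ at a h
      a'≡a+h = trans a'≡ (cong (at a) oa≡h)

    not-enclosed+h : h < oa → ¬ oa < h + d
    not-enclosed+h h<oa oa<h+d = ¬enclosing L.pair-ab+h d+h<h 0<oa-h oa-h<d+h c'
      where
      d+h≡d : cwdist N (at a h) (at b h) ≡ d
      d+h≡d = cwdist-translate N a b h L.a<N L.b<N
      d+h<h : cwdist N (at a h) (at b h) < h
      d+h<h = subst (_< h) (sym d+h≡d) L.d<h
      oa-h≡ : cwdist N (at a h) a' ≡ oa ∸ h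
      oa-h≡ = trans (cong (cwdist N (at a h)) a'≡) (cwdist-offsets-≤ N a h oa L.a<N (<⇒≤ h<oa) oa<N)
      0<oa-h : 0 < cwdist N (at a h) a'
      0<oa-h = subst (0 <_) (sym oa-h≡) (m<n⇒0<n∸m h<oa)
      oa-h<d+h : cwdist N (at a h) a' < cwdist N (at a h) (at b h)
      oa-h<d+h = subst₂ _<_ (sym oa-h≡) (sym d+h≡d)
                   (+-cancelʳ-< h _ d (subst₂ _<_ (sym (m∸n+n≡m (<⇒≤ h<oa))) (+-comm h d) oa<h+d))

    not-b+h : oa ≢ h + d
    not-b+h oa≡h+d = ¬longer (trans (cong₂ (cwdist N) a'≡b+h b'≡a+h) (cwdist-translate N b a h L.b<N L.a<N))
      where
      a'≡b+h : a' ≡ at b h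
      a'≡b+h = trans a'≡ (trans (cong (at a) (trans oa≡h+d (cong (h +_) (sym (+-identityʳ d)))))
                                (trans (sym (L.at-b+h 0)) (cong (_mod' N) (+-identityʳ (b + h)))))
      b'≡a+h : b' ≡ at a h
      b'≡a+h = atMostOne a' b' (at a h) L'.pair-ab (subst (λ z → S z (at a h) ≡ true) (sym a'≡b+h) (symm _ _ L.pair-ab+h))

    not-after-b+h : ¬ h + d < oa
    not-after-b+h h+d<oa = unpaired-⊥ (subst (Unpaired S) at-b+h≡a' (proj₂ (L.unpaired t (m<n⇒0<n∸m h+d<oa) t<gap))) L'.pair-ab
      where
      t = oa ∸ (h + d)
      at-b+h≡a' : (b + h + t) mod' N ≡ a'
      at-b+h≡a' = trans (L.at-b+h t) (trans (cong (at a) (trans (sym (+-assoc h d t)) (m+[n∸m]≡n (<⇒≤ h+d<oa)))) (sym a'≡))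
      t<gap : t < L.gap
      t<gap = +-cancelʳ-< (h + d) t L.gap (begin-strict
        t + (h + d)            ≡⟨ m∸n+n≡m (<⇒≤ h+d<oa) ⟩
        oa                     <⟨ oa<N ⟩
        N                      ≡⟨ N≡h+h ⟩
        h + h                  ≡⟨ cong (h +_) L.d+gap≡h ⟨
        h + (d + L.gap)        ≡⟨ cong (h +_) (+-comm d L.gap) ⟩
        h + (L.gap + d)        ≡⟨ x∙yz≈y∙xz h L.gap d ⟩
        L.gap + (h + d)        ∎)
        where open ≤-Reasoning

  -- The start a' of a second loop can only be a or a + h: anywhere else it is enclosed by one of the
  -- pairs (a, b), (a + h, b + h), lies on an unpaired stretch, or makes the second loop too long.
  centralLoop-unique : ∀ {a b a' b'} → CentralInternalLoop π S a b → CentralInternalLoop π S a' b' → SameLoop π a b a' b'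
  centralLoop-unique c c' = wherever-a'-lies
    where
    open TwoLoops c c'
    wherever-a'-lies : SameLoop π _ _ _ _
    wherever-a'-lies with <-cmp oa d | <-cmp oa h | <-cmp oa (h + d) | oa ≟ 0
    ... | tri< oa<d _ _ | _             | _                 | yes oa≡0 = at-a oa≡0
    ... | tri< oa<d _ _ | _             | _                 | no oa≢0  = ⊥-elim (not-enclosed (n≢0⇒n>0 oa≢0) oa<d)
    ... | tri≈ _ oa≡d _ | _             | _                 | _        = ⊥-elim (not-b oa≡d)
    ... | tri> _ _ d<oa | tri< oa<h _ _ | _                 | _        = ⊥-elim (not-after-b d<oa oa<h)
    ... | tri> _ _ _    | tri≈ _ oa≡h _ | _                 | _        = at-a+h oa≡h
    ... | tri> _ _ _    | tri> _ _ h<oa | tri< oa<h+d _ _   | _        = ⊥-elim (not-enclosed+h h<oa oa<h+d)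
    ... | tri> _ _ _    | tri> _ _ _    | tri≈ _ oa≡h+d _   | _        = ⊥-elim (not-b+h oa≡h+d)
    ... | tri> _ _ _    | tri> _ _ _    | tri> _ _ h+d<oa   | _        = ⊥-elim (not-after-b+h h+d<oa)

  sameLoop-sym : ∀ {a b a' b'} → a < N → b < N → SameLoop π a b a' b' → SameLoop π a' b' a b
  sameLoop-sym a<N b<N (inj₁ (refl , refl)) = inj₁ (refl , refl)
  sameLoop-sym a<N b<N (inj₂ (refl , refl)) = inj₂ (sym (at-h-at-h a<N) , sym (at-h-at-h b<N))

  sameLoop-trans : ∀ {a b a' b' a'' b''} → a < N → b < N → SameLoop π a b a' b' → SameLoop π a' b' a'' b'' → SameLoop π a b a'' b''
  sameLoop-trans a<N b<N (inj₁ (refl , refl)) s = s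
  sameLoop-trans a<N b<N (inj₂ s) (inj₁ (refl , refl)) = inj₂ s
  sameLoop-trans a<N b<N (inj₂ (refl , refl)) (inj₂ (refl , refl)) = inj₁ (at-h-at-h a<N , at-h-at-h b<N)

  mod'h-cases : ∀ {b} → b < N → b mod' h ≡ b ⊎ b mod' h ≡ at b h
  mod'h-cases = mod'-half-cases 0<h N≡h+h

  at-at-comm : ∀ p s t → at (at p s) t ≡ at (at p t) s
  at-at-comm p s t = trans (mod'-absorbˡ (p + s) t N)
                    (trans (cong (_mod' N) (trans (+-assoc p s t) (trans (cong (p +_) (+-comm s t)) (sym (+-assoc p t s)))))
                           (sym (mod'-absorbˡ (p + t) s N)))

  start-from-end : ∀ {x z} → x < N → z < N → x ≡ at z (N ∸ cwdist N x z)
  start-from-end {x} {z} x<N z<N = sym (begin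
    at z (N ∸ D)                      ≡⟨ cong (λ q → at q (N ∸ D)) (as-offset N x z x<N z<N) ⟩
    at (at x D) (N ∸ D)               ≡⟨ offset-rebase N x D N (<⇒≤ (cwdist-< N x z 0<N)) ⟩
    (x + N) mod' N                    ≡⟨ mod'-+N x N ⟩
    x mod' N                          ≡⟨ mod'-identity x<N ⟩
    x                                 ∎)
    where
    open ≡-Reasoning
    D = cwdist N x z

  -- A loop is determined by b and its length, and b up to the half-turn by b mod' h.
  loopCode-injective : ∀ {a₁ b₁ a₂ b₂} → a₁ < N → b₁ < N → a₂ < N → b₂ < N → cwdist N a₁ b₁ < h → cwdist N a₂ b₂ < h →
    b₁ mod' h ≡ b₂ mod' h → b₁ mod' h + (h ∸ cwdist N a₁ b₁) ≡ b₂ mod' h + (h ∸ cwdist N a₂ b₂) → SameLoop π a₁ b₁ a₂ b₂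
  loopCode-injective {a₁} {b₁} {a₂} {b₂} a₁<N b₁<N a₂<N b₂<N d₁<h d₂<h u≡ w≡ = byHalf (mod'h-cases b₁<N) (mod'h-cases b₂<N)
    where
    d₁ = cwdist N a₁ b₁
    d₂ = cwdist N a₂ b₂
    d₁≡d₂ : d₁ ≡ d₂
    d₁≡d₂ = ∸-cancelˡ-≡ (<⇒≤ d₁<h) (<⇒≤ d₂<h) (+-cancelˡ-≡ (b₁ mod' h) _ _ (trans w≡ (cong (_+ (h ∸ d₂)) (sym u≡))))
    same-b : b₁ ≡ b₂ → a₁ ≡ a₂
    same-b b₁≡b₂ = trans (start-from-end a₁<N b₁<N) (trans (cong₂ (λ p q → at p (N ∸ q)) b₁≡b₂ d₁≡d₂) (sym (start-from-end a₂<N b₂<N)))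
    turned-b : b₂ ≡ at b₁ h → a₂ ≡ at a₁ h
    turned-b b₂≡ = begin
      a₂                          ≡⟨ start-from-end a₂<N b₂<N ⟩
      at b₂ (N ∸ d₂)              ≡⟨ cong₂ (λ p q → at p (N ∸ q)) b₂≡ (sym d₁≡d₂) ⟩
      at (at b₁ h) (N ∸ d₁)       ≡⟨ at-at-comm b₁ h (N ∸ d₁) ⟩
      at (at b₁ (N ∸ d₁)) h       ≡⟨ cong (λ p → at p h) (start-from-end a₁<N b₁<N) ⟨
      at a₁ h                     ∎
      where open ≡-Reasoning
    byHalf : b₁ mod' h ≡ b₁ ⊎ b₁ mod' h ≡ at b₁ h → b₂ mod' h ≡ b₂ ⊎ b₂ mod' h ≡ at b₂ h → SameLoop π a₁ b₁ a₂ b₂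
    byHalf (inj₁ r₁) (inj₁ r₂) = inj₁ (sym (same-b b₁≡b₂) , sym b₁≡b₂)
      where b₁≡b₂ = trans (sym r₁) (trans u≡ r₂)
    byHalf (inj₁ r₁) (inj₂ r₂) = inj₂ (turned-b b₂≡ , b₂≡)
      where b₂≡ = trans (sym (at-h-at-h b₂<N)) (cong (λ p → at p h) (trans (sym r₂) (trans (sym u≡) r₁)))
    byHalf (inj₂ r₁) (inj₁ r₂) = inj₂ (turned-b b₂≡ , b₂≡)
      where b₂≡ = trans (sym r₂) (trans (sym u≡) r₁)
    byHalf (inj₂ r₁) (inj₂ r₂) = inj₁ (sym (same-b b₁≡b₂) , sym b₁≡b₂)
      where b₁≡b₂ = trans (sym (at-h-at-h b₁<N)) (trans (cong (λ p → at p h) (trans (sym r₁) (trans u≡ r₂))) (at-h-at-h b₂<N))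

  ¬bond-before-h : ¬ Bond π (h ∸ 1)
  ¬bond-before-h = subst (λ p → ¬ Bond π p) lastOfCopy
    (Repetition.¬bond-copy-end y v ne y≢[] (g ∸ 1) (L ∸ 1) (≤-<-trans (m∸n≤m g 1) g<v) (m+[n∸m]≡n 0<L))
    where
    lastOfCopy : (g ∸ 1) * L + (L ∸ 1) ≡ h ∸ 1
    lastOfCopy = trans (pred-*-split 0<g 0<L) (cong (_∸ 1) (sym h≡gL))

  -- The code (b mod' h, b mod' h + gap) of a loop: two complementary positions in the first half, the
  -- first one an uncovered bond.
  module LoopCode {a b : ℕ} (c : CentralInternalLoop π S a b) where

    open Loop c

    u = b mod' h
    w = u + gap

    u<h : u < h
    u<h = mod'-< b 0<h

    u<N : u < N
    u<N = <-trans u<h h<N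

    bonds-from-u : ∀ t → t < gap → Bond π (at u t)
    bonds-from-u t t<gap = [ (λ u≡b → subst (λ z → Bond π (at z t)) (sym u≡b) (proj₁ (bonds t t<gap)))
                           , (λ u≡b+h → subst (Bond π) (trans (sym (mod'-absorbˡ (b + h) t N)) (cong (λ z → at z t) (sym u≡b+h))) (proj₂ (bonds t t<gap)))
                           ]′ (mod'h-cases b<N)

    -- Otherwise the bonds from u on would reach the nick ending the first half.
    w<h : w < h
    w<h = ≰⇒> λ h≤w → ¬bond-before-h (subst (Bond π) end≡ (bonds-from-u (h ∸ 1 ∸ u) (t<gap h≤w)))
      where
      u+t≡ : u + (h ∸ 1 ∸ u) ≡ h ∸ 1
      u+t≡ = m+[n∸m]≡n (≤-pred (subst (suc u ≤_) (sym (m+[n∸m]≡n 0<h)) u<h))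
      t<gap : h ≤ w → h ∸ 1 ∸ u < gap
      t<gap h≤w = +-cancelˡ-< u _ gap (subst (_< w) (sym u+t≡) (<-≤-trans (∸-monoʳ-< {n = 1} (s≤s z≤n) 0<h) h≤w))
      end≡ : at u (h ∸ 1 ∸ u) ≡ h ∸ 1
      end≡ = trans (cong (_mod' N) u+t≡) (mod'-identity (≤-<-trans (m∸n≤m h 1) h<N))

    u<w : u < w
    u<w = subst (_< w) (+-identityʳ u) (+-monoʳ-< u 0<gap)

    bond-u : Bond π u
    bond-u = subst (Bond π) (mod'-+0 u<N) (bonds-from-u 0 0<gap)

    uncovered-u : Uncovered u
    uncovered-u = [ (λ u≡b → subst Uncovered (sym u≡b) uncovered-b)
                  , (λ u≡b+h → subst Uncovered (sym (trans u≡b+h (at-h≡rotate b))) (uncovered-rotate g (<⇒≤ g<v) invariant-g b<N uncovered-b))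
                  ]′ (mod'h-cases b<N)

    base-u : nth (bases π) u ≡ nth (bases π) b
    base-u = [ cong (nth (bases π))
             , (λ u≡b+h → trans (cong (nth (bases π)) (trans u≡b+h (at-h≡rotate b))) (nth-bases-rotate g b<N))
             ]′ (mod'h-cases b<N)

    base-w : nth (bases π) w ≡ nth (bases π) a
    base-w = [ first-half , second-half ]′ (mod'h-cases b<N)
      where
      first-half : u ≡ b → nth (bases π) w ≡ nth (bases π) a
      first-half u≡b = begin
        nth (bases π) (u + gap)          ≡⟨ cong (nth (bases π)) (mod'-identity (<-trans w<h h<N)) ⟨
        nth (bases π) (at u gap)         ≡⟨ cong (λ z → nth (bases π) (at z gap)) u≡b ⟩
        nth (bases π) (at b gap)         ≡⟨ cong (nth (bases π)) (trans at-b-gap (at-h≡rotate a)) ⟩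
        nth (bases π) (rotate g a)       ≡⟨ nth-bases-rotate g a<N ⟩
        nth (bases π) a                  ∎
        where open ≡-Reasoning
      second-half : u ≡ at b h → nth (bases π) w ≡ nth (bases π) a
      second-half u≡b+h = cong (nth (bases π)) (begin
        u + gap                          ≡⟨ mod'-identity (<-trans w<h h<N) ⟨
        at u gap                         ≡⟨ cong (λ z → at z gap) u≡b+h ⟩
        at (at b h) gap                  ≡⟨ at-at-comm b h gap ⟩
        at (at b gap) h                  ≡⟨ cong (λ z → at z h) at-b-gap ⟩
        at (at a h) h                    ≡⟨ at-h-at-h a<N ⟩
        a                                ∎)
        where open ≡-Reasoning

    complementary-u-w : complementaryᵇ (nth (bases π) u) (nth (bases π) w) ≡ true
    complementary-u-w = subst₂ (λ p q → complementaryᵇ p q ≡ true) (sym base-u) (sym base-w) (paired⇒complementaryᵇ (compl a b pair-ab))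

-- Coding the structures

σ-proper : ∀ v → Σ< v (λ d → 𝟙 (does ((suc d ∣? v) ×-dec (suc d <? v))) * suc d) + v ≡ σ v
σ-proper zero     = refl
σ-proper v@(suc v′) = begin
  Σ< v′ proper + proper v′ + v            ≡⟨ cong (λ z → Σ< v′ proper + z + v) (cong (λ b → 𝟙 b * v) (dec-false ((v ∣? v) ×-dec (v <? v)) (λ (_ , v<v) → <-irrefl refl v<v))) ⟩
  Σ< v′ proper + 0 + v                    ≡⟨ cong (_+ v) (trans (+-identityʳ _) (Σ<-cong v′ (λ d d<v′ → divisor (suc d ∣? v) (s≤s d<v′)))) ⟩
  Σ< v′ (divisorOrZero ∘ suc) + v         ≡⟨ cong (Σ< v′ (divisorOrZero ∘ suc) +_) (divisor-v (v ∣? v)) ⟨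
  Σ< v (divisorOrZero ∘ suc)              ≡⟨ sum-map-upTo v (divisorOrZero ∘ suc) ⟨
  sum (map (divisorOrZero ∘ suc) (upTo v)) ≡⟨ cong sum (map-∘ (upTo v)) ⟩
  σ v                                     ∎
  where
  open ≡-Reasoning
  proper : ℕ → ℕ
  proper d = 𝟙 (does ((suc d ∣? v) ×-dec (suc d <? v))) * suc d
  divisorOrZero : ℕ → ℕ
  divisorOrZero d = if does (d ∣? v) then d else 0
  divisor : ∀ {d} → (d∣? : Dec (suc d ∣ v)) → suc d < v → 𝟙 (does (d∣? ×-dec (suc d <? v))) * suc d ≡ (if does d∣? then suc d else 0)
  divisor {d} (yes _) d<v = trans (cong (λ b → 𝟙 b * suc d) (dec-true (suc d <? v) d<v)) (+-identityʳ (suc d))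
  divisor (no _)    _   = refl
  divisor-v : (v∣? : Dec (v ∣ v)) → (if does v∣? then v else 0) ≡ v
  divisor-v (yes _)  = refl
  divisor-v (no v∤v) = contradiction ∣-refl v∤v

module Codes (y : Ordering) (v : ℕ) {{_ : NonZero v}} (ne : NonEmptyStrands y) (y≢[] : y ≢ []) where

  π = rep v y
  N = nBases π
  L = nBases y
  h = half π

  instance
    L≢0 : NonZero L
    L≢0 = >-nonZero (nBases-positive y ne y≢[])

  record WellFormed (S : Structure) : Set where
    constructor wellFormed
    field
      secondary       : IsSecStruct π S
      connected       : Connected π S
      unpseudoknotted : Unpseudoknotted S
      symmetric       : 2 ≤ symDeg π y v S

  open WellFormed

  HasCentralLoop : Structure → Set
  HasCentralLoop S = Σ[ a ∈ ℕ ] Σ[ b ∈ ℕ ] CentralInternalLoop π S a b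

  data Code : Set where
    cut  : ℕ → ℕ → Code
    loop : ℕ → ℕ → Code

  -- cut g b: the admissible (v / g)-symmetric backbone cut through the bond b;
  -- loop u w: the central internal loop of code (u, w) of a 2-fold symmetric structure.
  Encodes : Structure → Code → Set
  Encodes S (cut g b)  = g * symDeg π y v S ≡ v × Admissible π y v S (symDeg π y v S) b ×
                         (symDeg π y v S ≡ 2 → ¬ HasCentralLoop S)
  Encodes S (loop u w) = symDeg π y v S ≡ 2 × Admissible π y v S 2 u ×
                         Σ[ a ∈ ℕ ] Σ[ b ∈ ℕ ] (CentralInternalLoop π S a b × b mod' h ≡ u × u + (h ∸ cdist π a b) ≡ w)

  properDivisor? : ∀ g → Dec (g ∣ v × g < v)
  properDivisor? g = (g ∣? v) ×-dec (g <? v)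

  bondᵇ : ℕ → Bool
  bondᵇ b = does (joined? (labels y 0) (b % L))

  complementaryᵇ-at : ℕ → ℕ → Bool
  complementaryᵇ-at u w = complementaryᵇ (nth (bases π) u) (nth (bases π) w)

  cutCodes : List Code
  cutCodes = ⋃< v λ d → when (does (properDivisor? (suc d))) (⋃< (suc d * L) λ b → when (bondᵇ b) (cut (suc d) b ∷ []))

  loopCodes : List Code
  loopCodes = ⋃< h λ w → ⋃< w λ u → when (complementaryᵇ-at u w) (loop u w ∷ [])

  codes : List Code
  codes = cutCodes ++ loopCodes

  cut∈codes : ∀ {g b} → 0 < g → g ∣ v → g < v → b < g * L → Bond π b → cut g b ∈ codes
  cut∈codes {suc d} {b} _ g∣v g<v b<gL bond =
    ∈-++⁺ˡ (∈-⋃< (<-trans (n<1+n d) g<v) (∈-when (dec-true (properDivisor? (suc d)) (g∣v , g<v))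
      (∈-⋃< b<gL (∈-when (dec-true (joined? (labels y 0) (b % L)) (Repetition.bond⇒joined-% y v ne y≢[] b bond)) (here refl)))))

  loop∈codes : ∀ {u w} → u < w → w < h → complementaryᵇ-at u w ≡ true → loop u w ∈ codes
  loop∈codes {u} {w} u<w w<h compl = ∈-++⁺ʳ cutCodes (∈-⋃< w<h (∈-⋃< u<w (∈-when compl (here refl))))

  Encoding : Structure → Set
  Encoding S = Σ[ κ ∈ Code ] κ ∈ codes × Encodes S κ

  module _ {S : Structure} (wf : WellFormed S) where

    open SymmetricStructure y v ne y≢[] S (secondary wf) (unpseudoknotted wf) (connected wf) (symmetric wf) hiding (π; N; L; L≢0)

    encodeByCut : (R ≡ 2 → ¬ HasCentralLoop S) → ¬ ¬ Encoding S
    encodeByCut noLoop ¬enc = ¬¬-uncoveredBond λ (u , u<N , bond , unc) → viaFirst (uncoveredBond-first u<N bond unc)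
      where
      viaFirst : Σ[ b ∈ ℕ ] b < g * L × Bond π b × Uncovered b → ⊥
      viaFirst (b , b<gL , bond-b , unc-b) =
        ¬enc (cut g b , cut∈codes 0<g g∣v g<v b<gL bond-b , g*R≡v , admissible (<-trans b<gL gL<N) bond-b unc-b , noLoop)

    encodeByLoop : (R≡2 : R ≡ 2) → HasCentralLoop S → Encoding S
    encodeByLoop R≡2 (a , b , c) =
      loop u w , loop∈codes u<w w<h complementary-u-w , R≡2 ,
      subst (λ R → Admissible π y v S R u) R≡2 (admissible u<N bond-u uncovered-u) , a , b , c , refl , refl
      where open HalfTurnSymmetric.LoopCode y v ne y≢[] S (secondary wf) (unpseudoknotted wf) (connected wf) R≡2 c

    encode : ¬ ¬ Encoding S
    encode ¬enc = ¬¬-excluded-middle byCases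
      where
      byCases : ¬ Dec (R ≡ 2 × HasCentralLoop S)
      byCases (yes (R≡2 , hasLoop)) = ¬enc (encodeByLoop R≡2 hasLoop)
      byCases (no ¬loop)            = encodeByCut (λ R≡2 hasLoop → ¬loop (R≡2 , hasLoop)) ¬enc

  cofactor-unique : ∀ {g m n} → g * m ≡ v → g * n ≡ v → m ≡ n
  cofactor-unique {zero}  eq _   = contradiction (sym eq) (≢-nonZero⁻¹ v)
  cofactor-unique {suc g} {m} {n} eq eq′ = *-cancelˡ-≡ m n (suc g) (trans eq (sym eq′))

  module _ {S₁ S₂ : Structure} (wf₁ : WellFormed S₁) (wf₂ : WellFormed S₂)
    (noCommonCut : ∀ R → 2 < R → symDeg π y v S₁ ≡ R → symDeg π y v S₂ ≡ R → ¬ CommonCut π y v S₁ S₂ R)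
    (noCommonHalfTurnCut : symDeg π y v S₁ ≡ 2 → symDeg π y v S₂ ≡ 2 →
                           ¬ CommonCut π y v S₁ S₂ 2 ⊎ DifferentCIL π S₁ S₂) where

    private
      R₁ = symDeg π y v S₁
      R₂ = symDeg π y v S₂

    -- Structures of equal symmetry sharing an admissible cut are excluded by hypothesis, unless
    -- they are 2-fold symmetric with different central internal loops; but cut codes are only
    -- used for 2-fold symmetric structures without a central internal loop.
    cutCollision : R₁ ≡ R₂ → CommonCut π y v S₁ S₂ R₁ → (R₁ ≡ 2 → ¬ HasCentralLoop S₁) → ⊥
    cutCollision R₁≡R₂ common noLoop₁ with m≤n⇒m<n∨m≡n (symmetric wf₁)
    ... | inj₁ 2<R₁ = noCommonCut R₁ 2<R₁ refl (sym R₁≡R₂) common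
    ... | inj₂ 2≡R₁ with noCommonHalfTurnCut (sym 2≡R₁) (trans (sym R₁≡R₂) (sym 2≡R₁))
    ...   | inj₁ ¬common = ¬common (subst (CommonCut π y v S₁ S₂) (sym 2≡R₁) common)
    ...   | inj₂ (x₁ , y₁ , _ , _ , cx₁ , _) = noLoop₁ (sym 2≡R₁) (x₁ , y₁ , cx₁)

    -- Both central loops are the unique loop of their structure, and they have the same code.
    loopCollision : ∀ {a₁ b₁ a₂ b₂} → (R₁≡2 : R₁ ≡ 2) (R₂≡2 : R₂ ≡ 2) →
      CentralInternalLoop π S₁ a₁ b₁ → CentralInternalLoop π S₂ a₂ b₂ →
      b₁ mod' h ≡ b₂ mod' h → b₁ mod' h + (h ∸ cdist π a₁ b₁) ≡ b₂ mod' h + (h ∸ cdist π a₂ b₂) → ¬ DifferentCIL π S₁ S₂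
    loopCollision R₁≡2 R₂≡2 c₁ c₂ u≡ w≡ (x₁ , y₁ , x₂ , y₂ , cx₁ , cx₂ , ¬same) =
      ¬same (HT₁.sameLoop-trans X₁.a<N X₁.b<N (HT₁.sameLoop-sym L₁.a<N L₁.b<N (HT₁.centralLoop-unique c₁ cx₁))
              (HT₁.sameLoop-trans L₁.a<N L₁.b<N
                (HT₁.loopCode-injective L₁.a<N L₁.b<N L₂.a<N L₂.b<N L₁.d<h L₂.d<h u≡ w≡)
                (HT₂.centralLoop-unique c₂ cx₂)))
      where
      module HT₁ = HalfTurnSymmetric y v ne y≢[] S₁ (secondary wf₁) (unpseudoknotted wf₁) (connected wf₁) R₁≡2
      module HT₂ = HalfTurnSymmetric y v ne y≢[] S₂ (secondary wf₂) (unpseudoknotted wf₂) (connected wf₂) R₂≡2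
      module L₁ = HT₁.Loop c₁
      module L₂ = HT₂.Loop c₂
      module X₁ = HT₁.Loop cx₁

    encodes-distinct : ∀ κ → Encodes S₁ κ → ¬ Encodes S₂ κ
    encodes-distinct (cut g b) (gR₁ , adm₁ , noLoop₁) (gR₂ , adm₂ , _) =
      cutCollision R₁≡R₂ (b , adm₁ , subst (λ R → Admissible π y v S₂ R b) (sym R₁≡R₂) adm₂) noLoop₁
      where
      R₁≡R₂ : R₁ ≡ R₂
      R₁≡R₂ = cofactor-unique {g} gR₁ gR₂
    encodes-distinct (loop u w) (R₁≡2 , adm₁ , a₁ , b₁ , c₁ , u₁ , w₁) (R₂≡2 , adm₂ , a₂ , b₂ , c₂ , u₂ , w₂)
      with noCommonHalfTurnCut R₁≡2 R₂≡2
    ... | inj₁ ¬common = ¬common (u , adm₁ , adm₂)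
    ... | inj₂ different = loopCollision R₁≡2 R₂≡2 c₁ c₂ (trans u₁ (sym u₂))
                             (trans (cong (_+ _) u₁) (trans w₁ (sym (trans (cong (_+ _) u₂) w₂)))) different

  bondsPerCopy : ℕ
  bondsPerCopy = Σ< L (𝟙 ∘ bondᵇ)

  v*bondsPerCopy : v * bondsPerCopy ≡ N ∸ nStrands π
  v*bondsPerCopy = begin
    v * bondsPerCopy                 ≡⟨ cong (v *_) bondsPerCopy≡ ⟩
    v * (L ∸ length y)               ≡⟨ *-distribˡ-∸ v L (length y) ⟩
    v * L ∸ v * length y             ≡⟨ cong₂ _∸_ (nBases-rep v y) (nStrands-rep v y) ⟨
    N ∸ nStrands π                   ∎
    where
    open ≡-Reasoning
    bondsPerCopy≡ : bondsPerCopy ≡ L ∸ length y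
    bondsPerCopy≡ = trans (sym (m+n∸n≡m bondsPerCopy (length y)))
                          (cong (_∸ length y) (trans (cong (_+ length y) (Σ<-cong L (λ b b<L → cong (λ r → 𝟙 (does (joined? (labels y 0) r))) (m<n⇒m%n≡m b<L))))
                                                     (joins-labels y 0 ne)))

  length-cutCodes : length cutCodes ≡ bondsPerCopy * (σ v ∸ v)
  length-cutCodes = begin
    length cutCodes                                            ≡⟨ length-⋃< v _ ⟩
    Σ< v (λ d → length (when (properᵇ d) (cutsOf d)))          ≡⟨ Σ<-cong v (λ d _ → trans (length-when (properᵇ d) (cutsOf d)) (cong (𝟙 (properᵇ d) *_) (length-cutsOf d))) ⟩
    Σ< v (λ d → 𝟙 (properᵇ d) * (suc d * bondsPerCopy))        ≡⟨ Σ<-cong v (λ d _ → rearrange (𝟙 (properᵇ d)) (suc d) bondsPerCopy) ⟩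
    Σ< v (λ d → bondsPerCopy * (𝟙 (properᵇ d) * suc d))        ≡⟨ Σ<-*ˡ v bondsPerCopy _ ⟩
    bondsPerCopy * Σ< v (λ d → 𝟙 (properᵇ d) * suc d)          ≡⟨ cong (bondsPerCopy *_) (trans (sym (m+n∸n≡m _ v)) (cong (_∸ v) (σ-proper v))) ⟩
    bondsPerCopy * (σ v ∸ v)                                   ∎
    where
    open ≡-Reasoning
    properᵇ : ℕ → Bool
    properᵇ d = does (properDivisor? (suc d))
    cutsOf : ℕ → List Code
    cutsOf d = ⋃< (suc d * L) λ b → when (bondᵇ b) (cut (suc d) b ∷ [])
    length-cutsOf : ∀ d → length (cutsOf d) ≡ suc d * bondsPerCopy
    length-cutsOf d = begin
      length (cutsOf d)                    ≡⟨ length-⋃< (suc d * L) _ ⟩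
      Σ< (suc d * L) (λ b → length (when (bondᵇ b) (cut (suc d) b ∷ [])))
                                           ≡⟨ Σ<-cong (suc d * L) (λ b _ → trans (length-when (bondᵇ b) _) (*-identityʳ _)) ⟩
      Σ< (suc d * L) (𝟙 ∘ bondᵇ)           ≡⟨ Σ<-periodic (suc d) L (𝟙 ∘ bondᵇ) (λ k → cong (λ r → 𝟙 (does (joined? (labels y 0) r))) (trans (cong (_% L) (+-comm L k)) ([m+n]%n≡m%n k L))) ⟩
      suc d * bondsPerCopy                 ∎
    rearrange : ∀ a b c → a * (b * c) ≡ c * (a * b)
    rearrange a b c = trans (sym (*-assoc a b c)) (*-comm (a * b) c)

  16*length-loopCodes≤N² : 16 * length loopCodes ≤ N * N
  16*length-loopCodes≤N² = begin
    16 * length loopCodes                             ≡⟨ cong (16 *_) length≡ ⟩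
    16 * complementaryPairs (nth (bases π)) h         ≡⟨ *-assoc 4 4 (complementaryPairs (nth (bases π)) h) ⟩
    4 * (4 * complementaryPairs (nth (bases π)) h)    ≤⟨ *-monoʳ-≤ 4 (4*complementaryPairs≤n² (nth (bases π)) h) ⟩
    4 * (h * h)                                       ≡⟨ solve 1 (λ h → con 4 :* (h :* h) := (con 2 :* h) :* (con 2 :* h)) refl h ⟩
    (2 * h) * (2 * h)                                 ≤⟨ *-mono-≤ 2h≤N 2h≤N ⟩
    N * N                                             ∎
    where
    open ≤-Reasoning
    2h≤N : 2 * h ≤ N
    2h≤N = subst (_≤ N) (*-comm (N / 2) 2) (m/n*n≤m N 2)
    length≡ : length loopCodes ≡ complementaryPairs (nth (bases π)) h
    length≡ = trans (length-⋃< h _) (Σ<-cong h λ w _ → trans (length-⋃< w _) (Σ<-cong w λ u _ → trans (length-when (complementaryᵇ-at u w) _) (*-identityʳ _)))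

  16v*length-codes≤ : 16 * v * length codes ≤ 16 * (N ∸ nStrands π) * (σ v ∸ v) + v * N * N
  16v*length-codes≤ = begin
    16 * v * length codes                                                  ≡⟨ cong (16 * v *_) (length-++ cutCodes) ⟩
    16 * v * (length cutCodes + length loopCodes)                          ≡⟨ *-distribˡ-+ (16 * v) _ _ ⟩
    16 * v * length cutCodes + 16 * v * length loopCodes                   ≡⟨ cong₂ _+_ cuts loops ⟩
    16 * (N ∸ nStrands π) * (σ v ∸ v) + v * (16 * length loopCodes)        ≤⟨ +-monoʳ-≤ _ (*-monoʳ-≤ v 16*length-loopCodes≤N²) ⟩
    16 * (N ∸ nStrands π) * (σ v ∸ v) + v * (N * N)                        ≡⟨ cong (16 * (N ∸ nStrands π) * (σ v ∸ v) +_) (*-assoc v N N) ⟨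
    16 * (N ∸ nStrands π) * (σ v ∸ v) + v * N * N                          ∎
    where
    open ≤-Reasoning
    cuts : 16 * v * length cutCodes ≡ 16 * (N ∸ nStrands π) * (σ v ∸ v)
    cuts = begin-equality
      16 * v * length cutCodes                     ≡⟨ cong (16 * v *_) length-cutCodes ⟩
      16 * v * (bondsPerCopy * (σ v ∸ v))          ≡⟨ *-assoc 16 v _ ⟩
      16 * (v * (bondsPerCopy * (σ v ∸ v)))        ≡⟨ cong (16 *_) (*-assoc v bondsPerCopy _) ⟨
      16 * (v * bondsPerCopy * (σ v ∸ v))          ≡⟨ cong (λ z → 16 * (z * (σ v ∸ v))) v*bondsPerCopy ⟩
      16 * ((N ∸ nStrands π) * (σ v ∸ v))          ≡⟨ *-assoc 16 (N ∸ nStrands π) (σ v ∸ v) ⟨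
      16 * (N ∸ nStrands π) * (σ v ∸ v)            ∎
    loops : 16 * v * length loopCodes ≡ v * (16 * length loopCodes)
    loops = trans (cong (_* length loopCodes) (*-comm 16 v)) (*-assoc v 16 _)

  module _ {n : ℕ} (S : Fin n → Structure) (wf : ∀ i → WellFormed (S i))
    (noCommonCut : ∀ i j → i ≢ j → ∀ R → 2 < R → symDeg π y v (S i) ≡ R → symDeg π y v (S j) ≡ R → ¬ CommonCut π y v (S i) (S j) R)
    (noCommonHalfTurnCut : ∀ i j → i ≢ j → symDeg π y v (S i) ≡ 2 → symDeg π y v (S j) ≡ 2 →
                           ¬ CommonCut π y v (S i) (S j) 2 ⊎ DifferentCIL π (S i) (S j)) where

    ¬¬-≤-length-codes : ¬ ¬ (n ≤ length codes)
    ¬¬-≤-length-codes = ¬¬-map (λ enc → injective⇒≤ (position-injective enc)) (¬¬-Π-Fin n (encode ∘ wf))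
      where
      position-injective : (enc : ∀ i → Encoding (S i)) → ∀ {i j} → index (proj₁ (proj₂ (enc i))) ≡ index (proj₁ (proj₂ (enc j))) → i ≡ j
      position-injective enc {i} {j} same with i ≟ᶠ j
      ... | yes i≡j = i≡j
      ... | no i≢j = ⊥-elim (encodes-distinct (wf i) (wf j) (noCommonCut i j i≢j) (noCommonHalfTurnCut i j i≢j)
                               (proj₁ (enc i)) (proj₂ (proj₂ (enc i))) (subst (Encodes (S j)) (sym same-code) (proj₂ (proj₂ (enc j)))))
        where
        same-code : proj₁ (enc i) ≡ proj₁ (enc j)
        same-code = trans (lookup-index (proj₁ (proj₂ (enc i)))) (trans (cong (lookup codes) same) (sym (lookup-index (proj₁ (proj₂ (enc j))))))

rep-[] : ∀ v → rep v ([] {A = Strand}) ≡ []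
rep-[] zero    = refl
rep-[] (suc v) = rep-[] v

-- The codes exist only up to double negation, which the decidable inequality absorbs.
lemma8 : (π y : Ordering) (v : ℕ) →
    π ≢ [] → All (λ s → s ≢ []) π →
    π ≡ rep v y → (∀ m y' → π ≡ rep m y' → m ≤ v) →
    (𝒯 : List Structure) →
    (∀ S → S ∈ 𝒯 →
      IsSecStruct π S × Connected π S × Unpseudoknotted S × 2 ≤ symDeg π y v S) →
    (∀ i j → i ≢ j → ¬ (∀ p q → lookup 𝒯 i p q ≡ lookup 𝒯 j p q)) →
    (∀ i j → i ≢ j → ∀ R → 2 < R →
      symDeg π y v (lookup 𝒯 i) ≡ R → symDeg π y v (lookup 𝒯 j) ≡ R →
      ¬ CommonCut π y v (lookup 𝒯 i) (lookup 𝒯 j) R) →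
    (∀ i j → i ≢ j →
      symDeg π y v (lookup 𝒯 i) ≡ 2 → symDeg π y v (lookup 𝒯 j) ≡ 2 →
      ¬ CommonCut π y v (lookup 𝒯 i) (lookup 𝒯 j) 2 ⊎
      DifferentCIL π (lookup 𝒯 i) (lookup 𝒯 j)) →
    16 * v * length 𝒯 ≤
      16 * (nBases π ∸ nStrands π) * (σ v ∸ v) + v * nBases π * nBases π
lemma8 π y zero π≢[] _ π≡ _ _ _ _ _ _ = contradiction π≡ π≢[]
lemma8 π y v@(suc _) π≢[] nonEmpty refl _ 𝒯 props _ noCommonCut noCommonHalfTurnCut =
  decidable-stable (_ ≤? _) (¬¬-map (λ n≤ → ≤-trans (*-monoʳ-≤ (16 * v) n≤) 16v*length-codes≤)
                                    (¬¬-≤-length-codes (lookup 𝒯) wf noCommonCut noCommonHalfTurnCut))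
  where
  y≢[] : y ≢ []
  y≢[] refl = π≢[] (rep-[] v)
  open Codes y v (All.++⁻ˡ y nonEmpty) y≢[]
  wf : ∀ i → WellFormed (lookup 𝒯 i)
  wf i = let ss , c , u , t = props _ (∈-lookup i) in wellFormed ss c u t
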